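{- Let $n,r$ be integers with $r>0$ and $n\geqslant 0$. Then $\sigma_r\,\mathrm{mex}(n)=\widetilde D_2^{(r)}(n)$.
   Context: For a positive integer $r$, the $r$-gap of a partition $\lambda$ is the least positive integer that does not appear at least $r$ times as a part of $\lambda$. $\sigma_r\,\mathrm{mex}(n)$ is the sum of the $r$-gaps of all partitions of $n$. A partition of $n$ using two colors $0,1$ is a pair $(\lambda^{(0)},\lambda^{(1)})$ of partitions (the parts of color $0$ and of color $1$) with total size $n$. $\widetilde D_2^{(r)}(n)$ is the number of partitions of $n$ using two colors $0,1$ such that (i) $\lambda^{(0)}$ is a partition into distinct parts, each divisible by $r$, and (ii) $\lambda^{(1)}$ is a partition in which each part is repeated at most $2r-1$ times. -}

module Defs where

open import Data.Nat using (ℕ; zero; suc; _+_; _*_; _∸_; _≤_; _<_; _≤?_; _<?_)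
open import Data.Nat.Properties using (_≟_)
open import Data.Nat.Divisibility using (_∣_; _∣?_)
open import Data.List using (List; []; _∷_; map; concatMap; filter; length; upTo)
open import Data.Nat.ListAction using (sum)
open import Data.Vec using (Vec; []; _∷_)
open import Data.Product using (_×_; _,_; proj₁; proj₂)
open import Data.Sum using (_⊎_)
open import Relation.Nullary using (Dec; yes; no; _×-dec_)
open import Relation.Nullary.Decidable using (_⊎-dec_)
open import Relation.Unary using (Decidable)
open import Relation.Binary.PropositionalEquality using (_≡_)

-- Partitions are encoded by multiplicity vectors.
-- A vector  m = (m₁ , … , m_k) : Vec ℕ k  (k = length) stands for the
-- partition having the part j exactly m_j times (j = 1 … k).
-- Every partition of n has all parts ≤ n and all multiplicities ≤ n,
-- so the partitions of n are in bijection with the vectors in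
-- Vec ℕ n, with entries in {0,…,n}, whose weight is n.

vecs : (k b : ℕ) → List (Vec ℕ k)
vecs zero    b = [] ∷ []
vecs (suc k) b = concatMap (λ x → map (x ∷_) (vecs k b)) (upTo (suc b))

weightFrom : ∀ {k} → ℕ → Vec ℕ k → ℕ
weightFrom j []       = 0
weightFrom j (m ∷ ms) = j * m + weightFrom (suc j) ms

weight : ∀ {k} → Vec ℕ k → ℕ
weight = weightFrom 1

partitions : (n : ℕ) → List (Vec ℕ n)
partitions n = filter (λ m → weight m ≟ n) (vecs n n)

-- r-gap: least positive integer j whose multiplicity is < r
-- (parts beyond the vector length have multiplicity 0 < r, as r > 0)
gap : ℕ → ∀ {k} → Vec ℕ k → ℕ
gap r []       = 1
gap r (m ∷ ms) with m <? r
... | yes _ = 1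
... | no  _ = suc (gap r ms)

σmex : (r n : ℕ) → ℕ
σmex r n = sum (map (gap r) (partitions n))

AllFrom : (ℕ → ℕ → Set) → ∀ {k} → ℕ → Vec ℕ k → Set
AllFrom P j []       = Data.Unit.⊤ where import Data.Unit
AllFrom P j (m ∷ ms) = P j m × AllFrom P (suc j) ms

allFrom? : (P : ℕ → ℕ → Set) → (∀ j m → Dec (P j m)) →
           ∀ {k} j (v : Vec ℕ k) → Dec (AllFrom P j v)
allFrom? P P? j []       = yes Data.Unit.tt where import Data.Unit
allFrom? P P? j (m ∷ ms) = P? j m ×-dec allFrom? P P? (suc j) ms

DistinctDivBy : ℕ → ℕ → ℕ → Set
DistinctDivBy r j m = m ≤ 1 × (m ≡ 0 ⊎ r ∣ j)

distinctDivBy? : ∀ r j m → Dec (DistinctDivBy r j m)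
distinctDivBy? r j m = (m ≤? 1) ×-dec ((m ≟ 0) ⊎-dec (r ∣? j))

AtMost : ℕ → ℕ → ℕ → Set
AtMost r j m = m ≤ 2 * r ∸ 1

atMost? : ∀ r j m → Dec (AtMost r j m)
atMost? r j m = m ≤? 2 * r ∸ 1

Good : (r n : ℕ) → Vec ℕ n × Vec ℕ n → Set
Good r n (a , b) = (weight a + weight b ≡ n)
                 × AllFrom (DistinctDivBy r) 1 a
                 × AllFrom (AtMost r) 1 b

good? : ∀ r n (p : Vec ℕ n × Vec ℕ n) → Dec (Good r n p)
good? r n (a , b) = (weight a + weight b ≟ n)
                  ×-dec (allFrom? (DistinctDivBy r) (distinctDivBy? r) 1 a
                  ×-dec allFrom? (AtMost r) (atMost? r) 1 b)

pairs : (n : ℕ) → List (Vec ℕ n × Vec ℕ n)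
pairs n = concatMap (λ a → map (a ,_) (vecs n n)) (vecs n n)

D2 : (r n : ℕ) → ℕ
D2 r n = length (filter (good? r n) (pairs n))

module Submission where

-- The r-gap of a partition is the number of i ≥ 0 such that each of the
-- parts 1, …, i occurs at least r times, so σ_r mex(n) is the coefficient
-- of q^n in  Σ_i q^{r·T(i)} / (q;q)_∞,  T(i) = 1 + … + i  (σmex-series),
-- while D̃₂⁽ʳ⁾(n) is that of  (-q^r;q^r)_∞ · Π_j (1 + q^j + … + q^{j(2r-1)})
-- (D2-series).  Both series are  Π_j (1 + q^j + … + q^{j(r-1)})  times a
-- series in q^r (Factorizations), and what remains after q^r ↦ q is Gauss's
--   (-q;q)_∞² = Σ_i q^{T(i)} / (q;q)_∞      (gauss, series-identity).
-- Gauss's identity comes from a finite Jacobi triple product: the number of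
-- subsets of {1, …, 2K} weighted by z^{size} q^{sum}, at z = q^{-K}, is both
-- q^{-T(K-1)} · 2(-q;q)_K (-q;q)_{K-1}  (TripleProduct) and a sum of
-- Gaussian binomial coefficients, which near the diagonal are partition
-- numbers (GaussIdentity).

open import Defs
open import Data.Nat using (ℕ; suc; _*_; _>_)
open import Relation.Binary.PropositionalEquality using (_≡_; sym; module ≡-Reasoning)

module Sums where

  open import Data.Nat
  open import Data.Nat.Properties
  open import Data.Bool using (if_then_else_)
  open import Relation.Binary.PropositionalEquality
  open import Relation.Nullary using (Dec; yes; no; ¬_; does; _×-dec_)
  open import Data.Empty using (⊥-elim)
  open ≡-Reasoning

  ind : ∀ {p} {Q : Set p} → Dec Q → ℕ
  ind d = if does d then 1 else 0

  ind-yes : ∀ {p} {Q : Set p} (d : Dec Q) → Q → ind d ≡ 1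
  ind-yes (yes _) q = refl
  ind-yes (no nq) q = ⊥-elim (nq q)

  ind-no : ∀ {p} {Q : Set p} (d : Dec Q) → ¬ Q → ind d ≡ 0
  ind-no (yes q) nq = ⊥-elim (nq q)
  ind-no (no _) nq = refl

  ind-× : ∀ {a b} {A : Set a} {B : Set b} (dA : Dec A) (dB : Dec B) → ind (dA ×-dec dB) ≡ ind dA * ind dB
  ind-× (yes _) (yes _) = refl
  ind-× (yes _) (no _) = refl
  ind-× (no _) (yes _) = refl
  ind-× (no _) (no _) = refl

  ind-⇔ : ∀ {A B : Set} (dA : Dec A) (dB : Dec B) → (A → B) → (B → A) → ind dA ≡ ind dB
  ind-⇔ (yes a) (yes b) f g = refl
  ind-⇔ (yes a) (no nb) f g = ⊥-elim (nb (f a))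
  ind-⇔ (no na) (yes b) f g = ⊥-elim (na (g b))
  ind-⇔ (no na) (no nb) f g = refl

  δ : ℕ → ℕ → ℕ
  δ a b = ind (a ≟ b)

  ι≤ : ℕ → ℕ → ℕ
  ι≤ a b = ind (a ≤? b)

  Σ< : ℕ → (ℕ → ℕ) → ℕ
  Σ< zero f = 0
  Σ< (suc n) f = f 0 + Σ< n (λ i → f (suc i))

  Σ-cong : ∀ n {f g : ℕ → ℕ} → (∀ i → i < n → f i ≡ g i) → Σ< n f ≡ Σ< n g
  Σ-cong zero h = refl
  Σ-cong (suc n) h = cong₂ _+_ (h 0 (s≤s z≤n)) (Σ-cong n (λ i i<n → h (suc i) (s≤s i<n)))

  +-interchange : ∀ a b c d → a + b + (c + d) ≡ a + c + (b + d)
  +-interchange a b c d = begin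
    a + b + (c + d)   ≡⟨ +-assoc a b (c + d) ⟩
    a + (b + (c + d)) ≡⟨ cong (a +_) (sym (+-assoc b c d)) ⟩
    a + (b + c + d)   ≡⟨ cong (λ x → a + (x + d)) (+-comm b c) ⟩
    a + (c + b + d)   ≡⟨ cong (a +_) (+-assoc c b d) ⟩
    a + (c + (b + d)) ≡⟨ sym (+-assoc a c (b + d)) ⟩
    a + c + (b + d)   ∎

  Σ-+ : ∀ n (f g : ℕ → ℕ) → Σ< n (λ i → f i + g i) ≡ Σ< n f + Σ< n g
  Σ-+ zero f g = refl
  Σ-+ (suc n) f g = trans (cong (f 0 + g 0 +_) (Σ-+ n (λ i → f (suc i)) (λ i → g (suc i))))
                          (+-interchange (f 0) (g 0) _ _)

  Σ-*ˡ : ∀ n c (f : ℕ → ℕ) → Σ< n (λ i → c * f i) ≡ c * Σ< n f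
  Σ-*ˡ zero c f = sym (*-zeroʳ c)
  Σ-*ˡ (suc n) c f = trans (cong (c * f 0 +_) (Σ-*ˡ n c (λ i → f (suc i)))) (sym (*-distribˡ-+ c (f 0) _))

  Σ-*ʳ : ∀ n c (f : ℕ → ℕ) → Σ< n (λ i → f i * c) ≡ Σ< n f * c
  Σ-*ʳ n c f = trans (Σ-cong n (λ i _ → *-comm (f i) c)) (trans (Σ-*ˡ n c f) (*-comm c _))

  Σ-zero : ∀ n (f : ℕ → ℕ) → (∀ i → i < n → f i ≡ 0) → Σ< n f ≡ 0
  Σ-zero n f h = trans (Σ-cong n h) (zeros n)
    where
    zeros : ∀ n → Σ< n (λ _ → 0) ≡ 0
    zeros zero = refl
    zeros (suc n) = zeros n

  Σ-swap : ∀ m n (h : ℕ → ℕ → ℕ) → Σ< m (λ i → Σ< n (λ j → h i j)) ≡ Σ< n (λ j → Σ< m (λ i → h i j))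
  Σ-swap zero n h = sym (Σ-zero n _ (λ _ _ → refl))
  Σ-swap (suc m) n h = begin
    Σ< n (h 0) + Σ< m (λ i → Σ< n (λ j → h (suc i) j))
      ≡⟨ cong (Σ< n (h 0) +_) (Σ-swap m n (λ i j → h (suc i) j)) ⟩
    Σ< n (h 0) + Σ< n (λ j → Σ< m (λ i → h (suc i) j))
      ≡⟨ sym (Σ-+ n (h 0) _) ⟩
    Σ< n (λ j → h 0 j + Σ< m (λ i → h (suc i) j)) ∎

  Σ-split : ∀ m n (f : ℕ → ℕ) → Σ< (m + n) f ≡ Σ< m f + Σ< n (λ i → f (m + i))
  Σ-split zero n f = refl
  Σ-split (suc m) n f = trans (cong (f 0 +_) (Σ-split m n (λ i → f (suc i)))) (sym (+-assoc (f 0) _ _))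

  Σ-last : ∀ n (f : ℕ → ℕ) → Σ< (suc n) f ≡ Σ< n f + f n
  Σ-last zero f = +-comm (f 0) 0
  Σ-last (suc n) f = trans (cong (f 0 +_) (Σ-last n (λ i → f (suc i)))) (sym (+-assoc (f 0) _ _))

  Σ-extend : ∀ m n (f : ℕ → ℕ) → m ≤ n → (∀ i → m ≤ i → i < n → f i ≡ 0) → Σ< m f ≡ Σ< n f
  Σ-extend m n f m≤n h = begin
    Σ< m f                                ≡⟨ sym (+-identityʳ _) ⟩
    Σ< m f + 0                            ≡⟨ cong (Σ< m f +_) (sym (Σ-zero (n ∸ m) _ tail0)) ⟩
    Σ< m f + Σ< (n ∸ m) (λ i → f (m + i)) ≡⟨ sym (Σ-split m (n ∸ m) f) ⟩
    Σ< (m + (n ∸ m)) f                    ≡⟨ cong (λ k → Σ< k f) (m+[n∸m]≡n m≤n) ⟩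
    Σ< n f                                ∎
    where
    tail0 : ∀ i → i < n ∸ m → f (m + i) ≡ 0
    tail0 i i< = h (m + i) (m≤m+n m i) (subst (m + i <_) (m+[n∸m]≡n m≤n) (+-monoʳ-< m i<))

  Σ-rev : ∀ n (f : ℕ → ℕ) → Σ< n f ≡ Σ< n (λ j → f (n ∸ suc j))
  Σ-rev zero f = refl
  Σ-rev (suc n) f = begin
    f 0 + Σ< n (λ i → f (suc i))              ≡⟨ cong (f 0 +_) (Σ-rev n (λ i → f (suc i))) ⟩
    f 0 + Σ< n (λ j → f (suc (n ∸ suc j)))    ≡⟨ cong (f 0 +_) (Σ-cong n (λ j j<n → cong f (sym (+-∸-assoc 1 j<n)))) ⟩
    f 0 + Σ< n (λ j → f (n ∸ j))              ≡⟨ +-comm (f 0) _ ⟩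
    Σ< n (λ j → f (n ∸ j)) + f 0              ≡⟨ cong (λ k → Σ< n (λ j → f (n ∸ j)) + f k) (sym (n∸n≡0 n)) ⟩
    Σ< n (λ j → f (n ∸ j)) + f (n ∸ n)        ≡⟨ sym (Σ-last n (λ j → f (suc n ∸ suc j))) ⟩
    Σ< (suc n) (λ j → f (suc n ∸ suc j))      ∎

  Σ-δ : ∀ n e (F : ℕ → ℕ) → e < n → Σ< n (λ x → δ e x * F x) ≡ F e
  Σ-δ (suc n) zero F _ =
    trans (cong₂ _+_ (+-identityʳ (F 0)) (Σ-zero n _ (λ _ _ → refl))) (+-identityʳ (F 0))
  Σ-δ (suc n) (suc e) F (s≤s e<n) = Σ-δ n e (λ i → F (suc i)) e<n

  Σ-δ-out : ∀ n e (F : ℕ → ℕ) → n ≤ e → Σ< n (λ x → δ e x * F x) ≡ 0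
  Σ-δ-out n e F n≤e = Σ-zero n _ (λ i i<n → cong (_* F i) (ind-no (e ≟ i) (λ e≡i → <⇒≢ (<-≤-trans i<n n≤e) (sym e≡i))))

module PowerSeries where

  open import Data.Nat
  open import Data.Nat.Properties
  open import Relation.Binary.PropositionalEquality
  open import Relation.Nullary using (yes; no)
  open import Data.Empty using (⊥-elim)
  open ≡-Reasoning
  open Sums

  Series : Set
  Series = ℕ → ℕ

  diag : (ℕ → ℕ → ℕ) → ℕ → ℕ
  diag h zero = h 0 0
  diag h (suc n) = h 0 (suc n) + diag (λ i j → h (suc i) j) n

  diag-cong : ∀ n {h h' : ℕ → ℕ → ℕ} → (∀ i j → i + j ≡ n → h i j ≡ h' i j) → diag h n ≡ diag h' n
  diag-cong zero e = e 0 0 refl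
  diag-cong (suc n) e = cong₂ _+_ (e 0 (suc n) refl) (diag-cong n (λ i j p → e (suc i) j (cong suc p)))

  diag-+ : ∀ n (h h' : ℕ → ℕ → ℕ) → diag (λ i j → h i j + h' i j) n ≡ diag h n + diag h' n
  diag-+ zero h h' = refl
  diag-+ (suc n) h h' = trans (cong (h 0 (suc n) + h' 0 (suc n) +_) (diag-+ n _ _))
                              (+-interchange (h 0 (suc n)) (h' 0 (suc n)) _ _)

  diag-*ˡ : ∀ n c (h : ℕ → ℕ → ℕ) → diag (λ i j → c * h i j) n ≡ c * diag h n
  diag-*ˡ zero c h = refl
  diag-*ˡ (suc n) c h = trans (cong (c * h 0 (suc n) +_) (diag-*ˡ n c _)) (sym (*-distribˡ-+ c _ _))

  diag-zero : ∀ n (h : ℕ → ℕ → ℕ) → (∀ i j → i + j ≡ n → h i j ≡ 0) → diag h n ≡ 0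
  diag-zero n h e = trans (diag-cong n e) (zeros n)
    where
    zeros : ∀ n → diag (λ _ _ → 0) n ≡ 0
    zeros zero = refl
    zeros (suc n) = zeros n

  diag-Σ : ∀ n (h : ℕ → ℕ → ℕ) → diag h n ≡ Σ< (suc n) (λ i → h i (n ∸ i))
  diag-Σ zero h = sym (+-identityʳ _)
  diag-Σ (suc n) h = cong (h 0 (suc n) +_) (diag-Σ n (λ i j → h (suc i) j))

  diag-Σ< : ∀ x n (h : ℕ → ℕ → ℕ → ℕ) → diag (λ a b → Σ< n (λ i → h i a b)) x ≡ Σ< n (λ i → diag (h i) x)
  diag-Σ< x zero h = diag-zero x _ (λ _ _ _ → refl)
  diag-Σ< x (suc n) h = trans (diag-+ x (h 0) _) (cong (diag (h 0) x +_) (diag-Σ< x n (λ i → h (suc i))))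

  diag-last : ∀ n (h : ℕ → ℕ → ℕ) → diag h (suc n) ≡ diag (λ i j → h i (suc j)) n + h (suc n) 0
  diag-last zero h = refl
  diag-last (suc n) h = trans (cong (h 0 (suc (suc n)) +_) (diag-last n (λ i j → h (suc i) j)))
                              (sym (+-assoc (h 0 (suc (suc n))) _ _))

  diag-swap : ∀ n (h : ℕ → ℕ → ℕ) → diag h n ≡ diag (λ i j → h j i) n
  diag-swap zero h = refl
  diag-swap (suc n) h = begin
    h 0 (suc n) + diag (λ i j → h (suc i) j) n ≡⟨ cong (h 0 (suc n) +_) (diag-swap n _) ⟩
    h 0 (suc n) + diag (λ i j → h (suc j) i) n ≡⟨ +-comm (h 0 (suc n)) _ ⟩
    diag (λ i j → h (suc j) i) n + h 0 (suc n) ≡⟨ sym (diag-last n (λ i j → h j i)) ⟩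
    diag (λ i j → h j i) (suc n)               ∎

  diag-assoc : ∀ n (h : ℕ → ℕ → ℕ → ℕ) →
    diag (λ i j → diag (λ a b → h a b j) i) n ≡ diag (λ a c → diag (λ b j → h a b j) c) n
  diag-assoc zero h = refl
  diag-assoc (suc n) h = begin
    h 0 0 (suc n) + diag (λ i j → diag (λ a b → h a b j) (suc i)) n
      ≡⟨ cong (h 0 0 (suc n) +_) (diag-+ n (λ i j → h 0 (suc i) j) (λ i j → diag (λ a b → h (suc a) b j) i)) ⟩
    h 0 0 (suc n) + (diag (λ i j → h 0 (suc i) j) n + diag (λ i j → diag (λ a b → h (suc a) b j) i) n)
      ≡⟨ sym (+-assoc (h 0 0 (suc n)) _ _) ⟩
    h 0 0 (suc n) + diag (λ i j → h 0 (suc i) j) n + diag (λ i j → diag (λ a b → h (suc a) b j) i) n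
      ≡⟨ cong (h 0 0 (suc n) + diag (λ i j → h 0 (suc i) j) n +_) (diag-assoc n (λ a b j → h (suc a) b j)) ⟩
    h 0 0 (suc n) + diag (λ i j → h 0 (suc i) j) n + diag (λ a c → diag (λ b j → h (suc a) b j) c) n ∎

  infixl 7 _⋆_
  infixl 6 _⊕_

  _⋆_ : Series → Series → Series
  (f ⋆ g) n = diag (λ i j → f i * g j) n

  _⊕_ : Series → Series → Series
  (f ⊕ g) n = f n + g n

  ε : Series
  ε zero = 1
  ε (suc _) = 0

  _≈_ : Series → Series → Set
  f ≈ g = ∀ n → f n ≡ g n

  _≈[_]_ : Series → ℕ → Series → Set
  f ≈[ N ] g = ∀ n → n ≤ N → f n ≡ g n

  ≈-refl : ∀ {f : Series} → f ≈ f
  ≈-refl n = refl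

  ≈-sym : ∀ {f g : Series} → f ≈ g → g ≈ f
  ≈-sym e n = sym (e n)

  ≈-trans : ∀ {f g h : Series} → f ≈ g → g ≈ h → f ≈ h
  ≈-trans e e' n = trans (e n) (e' n)

  ⋆-cong≤ : ∀ {f f' g g' : Series} N → f ≈[ N ] f' → g ≈[ N ] g' → (f ⋆ g) ≈[ N ] (f' ⋆ g')
  ⋆-cong≤ N ef eg n n≤N = diag-cong n (λ i j p →
    cong₂ _*_ (ef i (≤-trans (subst (i ≤_) p (m≤m+n i j)) n≤N)) (eg j (≤-trans (subst (j ≤_) p (m≤n+m j i)) n≤N)))

  ⋆-cong : ∀ {f f' g g' : Series} → f ≈ f' → g ≈ g' → (f ⋆ g) ≈ (f' ⋆ g')
  ⋆-cong ef eg n = diag-cong n (λ i j _ → cong₂ _*_ (ef i) (eg j))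

  ⋆-congʳ : ∀ f {g g' : Series} → g ≈ g' → (f ⋆ g) ≈ (f ⋆ g')
  ⋆-congʳ f = ⋆-cong (≈-refl {f})

  ⋆-comm : ∀ (f g : Series) → (f ⋆ g) ≈ (g ⋆ f)
  ⋆-comm f g n = trans (diag-swap n _) (diag-cong n (λ i j _ → *-comm (f j) (g i)))

  ⋆-assoc : ∀ (f g h : Series) → (f ⋆ g ⋆ h) ≈ (f ⋆ (g ⋆ h))
  ⋆-assoc f g h n = begin
    diag (λ i j → diag (λ a b → f a * g b) i * h j) n
      ≡⟨ diag-cong n (λ i j _ → trans (*-comm _ (h j)) (trans (sym (diag-*ˡ i (h j) _))
           (diag-cong i (λ a b _ → trans (*-comm (h j) _) (*-assoc (f a) (g b) (h j)))))) ⟩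
    diag (λ i j → diag (λ a b → f a * (g b * h j)) i) n
      ≡⟨ diag-assoc n (λ a b j → f a * (g b * h j)) ⟩
    diag (λ a c → diag (λ b j → f a * (g b * h j)) c) n
      ≡⟨ diag-cong n (λ a c _ → diag-*ˡ c (f a) _) ⟩
    diag (λ a c → f a * diag (λ b j → g b * h j) c) n ∎

  ⋆-interchange : ∀ a b c d → ((a ⋆ b) ⋆ (c ⋆ d)) ≈ ((a ⋆ c) ⋆ (b ⋆ d))
  ⋆-interchange a b c d =
    ≈-trans (⋆-assoc a b (c ⋆ d))
    (≈-trans (⋆-congʳ a (≈-trans (≈-sym (⋆-assoc b c d)) (≈-trans (⋆-cong (⋆-comm b c) (≈-refl {d})) (⋆-assoc c b d))))
    (≈-sym (⋆-assoc a c (b ⋆ d))))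

  ⋆-distribʳ : ∀ (f g h : Series) → ((f ⊕ g) ⋆ h) ≈ ((f ⋆ h) ⊕ (g ⋆ h))
  ⋆-distribʳ f g h n = trans (diag-cong n (λ i j _ → *-distribʳ-+ (h j) (f i) (g i))) (diag-+ n _ _)

  ⋆-distribˡ : ∀ (f g h : Series) → (f ⋆ (g ⊕ h)) ≈ ((f ⋆ g) ⊕ (f ⋆ h))
  ⋆-distribˡ f g h n = trans (⋆-comm f (g ⊕ h) n) (trans (⋆-distribʳ g h f n) (cong₂ _+_ (⋆-comm g f n) (⋆-comm h f n)))

  ε-⋆ : ∀ f → (ε ⋆ f) ≈ f
  ε-⋆ f zero = +-identityʳ _
  ε-⋆ f (suc n) = trans (cong₂ _+_ (+-identityʳ (f (suc n))) (diag-zero n _ (λ _ _ _ → refl))) (+-identityʳ _)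

  ⋆-ε : ∀ f → (f ⋆ ε) ≈ f
  ⋆-ε f n = trans (⋆-comm f ε n) (ε-⋆ f n)

  ΣS : ℕ → (ℕ → Series) → Series
  ΣS n F x = Σ< n (λ i → F i x)

  ⋆-ΣS : ∀ g n F → (g ⋆ ΣS n F) ≈ ΣS n (λ i → g ⋆ F i)
  ⋆-ΣS g n F x = trans (diag-cong x (λ a b _ → sym (Σ-*ˡ n (g a) (λ i → F i b)))) (diag-Σ< x n (λ i a b → g a * F i b))

  shift : ℕ → Series → Series
  shift zero f n = f n
  shift (suc d) f zero = 0
  shift (suc d) f (suc n) = shift d f n

  shift-low : ∀ d f n → n < d → shift d f n ≡ 0
  shift-low (suc d) f zero _ = refl
  shift-low (suc d) f (suc n) (s≤s n<d) = shift-low d f n n<d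

  shift-high : ∀ d f n → shift d f (d + n) ≡ f n
  shift-high zero f n = refl
  shift-high (suc d) f n = shift-high d f n

  shift-≤ : ∀ d f {n} → d ≤ n → shift d f n ≡ f (n ∸ d)
  shift-≤ d f d≤n = trans (cong (shift d f) (sym (m+[n∸m]≡n d≤n))) (shift-high d f _)

  shift-cong : ∀ d {f g} → f ≈ g → shift d f ≈ shift d g
  shift-cong zero e n = e n
  shift-cong (suc d) e zero = refl
  shift-cong (suc d) e (suc n) = shift-cong d e n

  shift-cong≤ : ∀ d {f g} N → f ≈[ N ] g → shift d f ≈[ N ] shift d g
  shift-cong≤ zero N e = e
  shift-cong≤ (suc d) N e zero _ = refl
  shift-cong≤ (suc d) N e (suc x) sx≤N = shift-cong≤ d N e x (≤-trans (n≤1+n x) sx≤N)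

  shift-shift : ∀ a b f → shift a (shift b f) ≈ shift (a + b) f
  shift-shift zero b f n = refl
  shift-shift (suc a) b f zero = refl
  shift-shift (suc a) b f (suc n) = shift-shift a b f n

  shift-⋆ : ∀ d f g → (shift d f ⋆ g) ≈ shift d (f ⋆ g)
  shift-⋆ zero f g n = refl
  shift-⋆ (suc d) f g zero = refl
  shift-⋆ (suc d) f g (suc n) = shift-⋆ d f g n

  ⋆-shift : ∀ d f g → (f ⋆ shift d g) ≈ shift d (f ⋆ g)
  ⋆-shift d f g n = trans (⋆-comm f (shift d g) n) (trans (shift-⋆ d g f n) (shift-cong d (⋆-comm g f) n))

  shift-⋆-shift : ∀ a b f g → (shift a f ⋆ shift b g) ≈ shift (a + b) (f ⋆ g)
  shift-⋆-shift a b f g n = trans (shift-⋆ a f (shift b g) n) (trans (shift-cong a (⋆-shift b f g) n) (shift-shift a b (f ⋆ g) n))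

  fixpoint-unique : ∀ d' (a h h' : Series) → h ≈ (a ⊕ shift (suc d') h) → h' ≈ (a ⊕ shift (suc d') h') → h ≈ h'
  fixpoint-unique d' a h h' e e' n = go n n ≤-refl
    where
    d = suc d'
    -- strong induction on m, through the bound B
    go : ∀ B m → m ≤ B → h m ≡ h' m
    go B m m≤B with m <? d
    ... | yes lt = trans (e m) (trans (cong (a m +_) (trans (shift-low d h m lt) (sym (shift-low d h' m lt)))) (sym (e' m)))
    go (suc B) m m≤B | no ge =
      trans (e m) (trans (cong (a m +_) (trans (shift-≤ d h (≮⇒≥ ge))
        (trans (go B (m ∸ d) smaller) (sym (shift-≤ d h' (≮⇒≥ ge)))))) (sym (e' m)))
      where
      smaller : m ∸ d ≤ B
      smaller = ≤-pred (≤-trans (∸-monoʳ-< {m} {d} {0} (s≤s z≤n) (≮⇒≥ ge)) m≤B)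
    go zero zero _ | no ge = ⊥-elim (ge (s≤s z≤n))

-- Dilation  f(q) ↦ f(q^d): the coefficient of q^n is f(n/d) when d ∣ n, else 0.
module Dilation where

  open import Data.Nat
  open import Data.Nat.Properties
  open import Data.Nat.Divisibility
  open import Relation.Binary.PropositionalEquality
  open import Relation.Nullary using (yes; no; ¬_)
  open import Data.Empty using (⊥-elim)
  open ≡-Reasoning
  open Sums
  open PowerSeries

  dilate : ℕ → Series → Series
  dilate d f n = Σ< (suc n) (λ x → δ (d * x) n * f x)

  dilate-at : ∀ d' f y → dilate (suc d') f (suc d' * y) ≡ f y
  dilate-at d' f y = trans (Σ-cong (suc (suc d' * y)) (λ x _ → cong (_* f x) (deltas x)))
                           (Σ-δ _ y f (s≤s (m≤n*m y (suc d'))))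
    where
    deltas : ∀ x → δ (suc d' * x) (suc d' * y) ≡ δ y x
    deltas x with y ≟ x
    ... | yes refl = trans (ind-yes (suc d' * x ≟ suc d' * x) refl) (sym (ind-yes (x ≟ x) refl))
    ... | no ne = trans (ind-no (suc d' * x ≟ suc d' * y) (λ p → ne (sym (*-cancelˡ-≡ x y (suc d') p))))
                        (sym (ind-no (y ≟ x) ne))

  dilate-off : ∀ d f n → ¬ (d ∣ n) → dilate d f n ≡ 0
  dilate-off d f n nd = Σ-zero (suc n) _ (λ x _ → cong (_* f x)
    (ind-no (d * x ≟ n) (λ p → nd (divides x (trans (sym p) (*-comm d x))))))

  dilate-cong : ∀ d {f g} → f ≈ g → dilate d f ≈ dilate d g
  dilate-cong d e n = Σ-cong (suc n) (λ x _ → cong (δ (d * x) n *_) (e x))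

  dilate-cong≤ : ∀ d {f g} N → f ≈[ N ] g → dilate d f ≈[ N ] dilate d g
  dilate-cong≤ d N e x x≤N = Σ-cong (suc x) (λ y y<sx → cong (δ (d * y) x *_) (e y (≤-trans (≤-pred y<sx) x≤N)))

  dilate-unique : ∀ d' (s f : Series) → (∀ x → s (suc d' * x) ≡ f x) → (∀ n → ¬ (suc d' ∣ n) → s n ≡ 0) →
    s ≈ dilate (suc d') f
  dilate-unique d' s f at off n with suc d' ∣? n
  ... | yes (divides q eq) = begin
    s n                           ≡⟨ cong s n≡dq ⟩
    s (suc d' * q)                ≡⟨ at q ⟩
    f q                           ≡⟨ sym (dilate-at d' f q) ⟩
    dilate (suc d') f (suc d' * q) ≡⟨ cong (dilate (suc d') f) (sym n≡dq) ⟩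
    dilate (suc d') f n           ∎
    where
    n≡dq : n ≡ suc d' * q
    n≡dq = trans eq (*-comm q (suc d'))
  ... | no nd = trans (off n nd) (sym (dilate-off (suc d') f n nd))

  dilate-low : ∀ d' F n → n < suc d' → dilate (suc d') F n ≡ ε n * F 0
  dilate-low d' F zero _ = trans (cong (dilate (suc d') F) (sym (*-zeroʳ (suc d')))) (trans (dilate-at d' F 0) (sym (+-identityʳ _)))
  dilate-low d' F (suc n) sn<d = dilate-off (suc d') F (suc n) (λ p → <⇒≱ sn<d (∣⇒≤ p))

  Σ-multiples : ∀ d' N (φ : ℕ → ℕ) → (∀ u → ¬ (suc d' ∣ u) → φ u ≡ 0) →
    Σ< (suc (suc d' * N)) φ ≡ Σ< (suc N) (λ a → φ (suc d' * a))
  Σ-multiples d' zero φ z = trans (cong (λ k → Σ< (suc k) φ) (*-zeroʳ (suc d'))) (cong (λ k → φ k + 0) (sym (*-zeroʳ (suc d'))))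
  Σ-multiples d' (suc N) φ z = begin
    Σ< (suc (d * suc N)) φ
      ≡⟨ cong (λ k → Σ< k φ) (cong suc (trans (*-suc d N) (+-comm d (d * N)))) ⟩
    Σ< (suc (d * N) + d) φ
      ≡⟨ Σ-split (suc (d * N)) d φ ⟩
    Σ< (suc (d * N)) φ + Σ< (suc d') (λ i → φ (suc (d * N) + i))
      ≡⟨ cong₂ _+_ (Σ-multiples d' N φ z) (Σ-last d' _) ⟩
    Σ< (suc N) (λ a → φ (d * a)) + (Σ< d' (λ i → φ (suc (d * N) + i)) + φ (suc (d * N) + d'))
      ≡⟨ cong (Σ< (suc N) (λ a → φ (d * a)) +_) (cong₂ _+_ (Σ-zero d' _ (λ i i<d' → z _ (between i i<d'))) (cong φ last)) ⟩
    Σ< (suc N) (λ a → φ (d * a)) + φ (d * suc N)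
      ≡⟨ sym (Σ-last (suc N) (λ a → φ (d * a))) ⟩
    Σ< (suc (suc N)) (λ a → φ (d * a)) ∎
    where
    d = suc d'
    last : suc (d * N) + d' ≡ d * suc N
    last = trans (+-comm (suc (d * N)) d') (trans (+-suc d' (d * N)) (sym (*-suc d N)))
    between : ∀ i → i < d' → ¬ (d ∣ suc (d * N) + i)
    between i i<d' p = <⇒≱ (s≤s i<d') (∣⇒≤ (∣m+n∣m⇒∣n (subst (d ∣_) (sym (+-suc (d * N) i)) p) (m∣m*n N)))

  dilate-⋆ : ∀ d' f g → dilate (suc d') (f ⋆ g) ≈ (dilate (suc d') f ⋆ dilate (suc d') g)
  dilate-⋆ d' f g = ≈-sym (dilate-unique d' (dilate d f ⋆ dilate d g) (f ⋆ g) at off)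
    where
    d = suc d'
    at : ∀ N → (dilate d f ⋆ dilate d g) (d * N) ≡ (f ⋆ g) N
    at N = begin
      diag (λ u v → dilate d f u * dilate d g v) (d * N) ≡⟨ diag-Σ (d * N) _ ⟩
      Σ< (suc (d * N)) (λ u → dilate d f u * dilate d g (d * N ∸ u))
        ≡⟨ Σ-multiples d' N _ (λ u nd → cong (_* dilate d g (d * N ∸ u)) (dilate-off d f u nd)) ⟩
      Σ< (suc N) (λ a → dilate d f (d * a) * dilate d g (d * N ∸ d * a))
        ≡⟨ Σ-cong (suc N) (λ a _ → cong₂ _*_ (dilate-at d' f a)
             (trans (cong (dilate d g) (sym (*-distribˡ-∸ d N a))) (dilate-at d' g (N ∸ a)))) ⟩
      Σ< (suc N) (λ a → f a * g (N ∸ a)) ≡⟨ sym (diag-Σ N _) ⟩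
      (f ⋆ g) N ∎
    off : ∀ n → ¬ (d ∣ n) → (dilate d f ⋆ dilate d g) n ≡ 0
    off n nd = trans (diag-Σ n _) (Σ-zero (suc n) _ term)
      where
      term : ∀ u → u < suc n → dilate d f u * dilate d g (n ∸ u) ≡ 0
      term u (s≤s u≤n) with d ∣? u
      ... | no ndu = cong (_* dilate d g (n ∸ u)) (dilate-off d f u ndu)
      ... | yes du = trans (cong (dilate d f u *_) (dilate-off d g (n ∸ u) (λ dn-u → nd (∣m∸n∣n⇒∣m d u≤n dn-u du))))
                           (*-zeroʳ (dilate d f u))

  dilate-ε : ∀ d' → dilate (suc d') ε ≈ ε
  dilate-ε d' = ≈-sym (dilate-unique d' ε ε at off)
    where
    at : ∀ x → ε (suc d' * x) ≡ ε x
    at zero = cong ε (*-zeroʳ d')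
    at (suc x) = refl
    off : ∀ n → ¬ (suc d' ∣ n) → ε n ≡ 0
    off zero nd = ⊥-elim (nd (divides 0 refl))
    off (suc n) _ = refl

  dilate-ΣS : ∀ d n F → dilate d (ΣS n F) ≈ ΣS n (λ i → dilate d (F i))
  dilate-ΣS d n F x = trans (Σ-cong (suc x) (λ y _ → sym (Σ-*ˡ n (δ (d * y) x) (λ i → F i y))))
                            (Σ-swap (suc x) n (λ y i → δ (d * y) x * F i y))

  dilate-dilate : ∀ a' b' f → dilate (suc a' * suc b') f ≈ dilate (suc a') (dilate (suc b') f)
  dilate-dilate a' b' f = ≈-sym (dilate-unique (b' + a' * suc b') (dilate a (dilate b f)) f at off)
    where
    a = suc a'
    b = suc b'
    at : ∀ x → dilate a (dilate b f) (a * b * x) ≡ f x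
    at x = trans (cong (dilate a (dilate b f)) (*-assoc a b x)) (trans (dilate-at a' (dilate b f) (b * x)) (dilate-at b' f x))
    off : ∀ n → ¬ (a * b ∣ n) → dilate a (dilate b f) n ≡ 0
    off n nd with a ∣? n
    ... | no na = dilate-off a (dilate b f) n na
    ... | yes (divides q eq) with b ∣? q
    ...   | no nb = trans (cong (dilate a (dilate b f)) (trans eq (*-comm q a))) (trans (dilate-at a' (dilate b f) q) (dilate-off b f q nb))
    ...   | yes (divides t eq2) = ⊥-elim (nd (divides t (trans eq (trans (cong (_* a) eq2) (trans (*-assoc t b a) (cong (t *_) (*-comm b a)))))))

  dilate-shift : ∀ r' a f → shift (suc r' * a) (dilate (suc r') f) ≈ dilate (suc r') (shift a f)
  dilate-shift r' a f = dilate-unique r' (shift (r * a) (dilate r f)) (shift a f) at off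
    where
    r = suc r'
    at : ∀ x → shift (r * a) (dilate r f) (r * x) ≡ shift a f x
    at x with x <? a
    ... | yes lt = trans (shift-low (r * a) _ (r * x) (*-monoʳ-< r lt)) (sym (shift-low a f x lt))
    ... | no ge = begin
      shift (r * a) (dilate r f) (r * x) ≡⟨ shift-≤ (r * a) (dilate r f) (*-monoʳ-≤ r (≮⇒≥ ge)) ⟩
      dilate r f (r * x ∸ r * a)         ≡⟨ cong (dilate r f) (sym (*-distribˡ-∸ r x a)) ⟩
      dilate r f (r * (x ∸ a))           ≡⟨ dilate-at r' f (x ∸ a) ⟩
      f (x ∸ a)                          ≡⟨ sym (shift-≤ a f (≮⇒≥ ge)) ⟩
      shift a f x                        ∎
    off : ∀ n → ¬ (r ∣ n) → shift (r * a) (dilate r f) n ≡ 0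
    off n nd with n <? r * a
    ... | yes lt = shift-low (r * a) _ n lt
    ... | no ge = trans (shift-≤ (r * a) (dilate r f) (≮⇒≥ ge))
                        (dilate-off r f _ (λ p → nd (subst (r ∣_) (m+[n∸m]≡n (≮⇒≥ ge)) (∣m∣n⇒∣m+n (m∣m*n a) p))))

  dilate-⋆-coeff : ∀ d' (F g : Series) n →
    (dilate (suc d') F ⋆ g) n ≡ Σ< (suc n) (λ x → ι≤ (suc d' * x) n * (F x * g (n ∸ suc d' * x)))
  dilate-⋆-coeff d' F g n = begin
    (dilate d F ⋆ g) n
      ≡⟨ diag-Σ n (λ u v → dilate d F u * g v) ⟩
    Σ< (suc n) (λ u → dilate d F u * g (n ∸ u))
      ≡⟨ Σ-cong (suc n) (λ u u<sn → cong (_* g (n ∸ u)) (Σ-extend (suc u) (suc n) _ u<sn (λ x u<x _ → beyond x u u<x))) ⟩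
    Σ< (suc n) (λ u → Σ< (suc n) (λ x → δ (d * x) u * F x) * g (n ∸ u))
      ≡⟨ Σ-cong (suc n) (λ u _ → sym (Σ-*ʳ (suc n) (g (n ∸ u)) (λ x → δ (d * x) u * F x))) ⟩
    Σ< (suc n) (λ u → Σ< (suc n) (λ x → δ (d * x) u * F x * g (n ∸ u)))
      ≡⟨ Σ-swap (suc n) (suc n) (λ u x → δ (d * x) u * F x * g (n ∸ u)) ⟩
    Σ< (suc n) (λ x → Σ< (suc n) (λ u → δ (d * x) u * F x * g (n ∸ u)))
      ≡⟨ Σ-cong (suc n) (λ x _ → trans (Σ-cong (suc n) {g = λ u → δ (d * x) u * (F x * g (n ∸ u))}
                                           (λ u _ → *-assoc (δ (d * x) u) (F x) _)) (select x)) ⟩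
    Σ< (suc n) (λ x → ι≤ (d * x) n * (F x * g (n ∸ d * x))) ∎
    where
    d = suc d'
    beyond : ∀ x u → u < x → δ (d * x) u * F x ≡ 0
    beyond x u u<x = cong (_* F x) (ind-no (d * x ≟ u) (λ p → <⇒≢ (<-≤-trans u<x (m≤n*m x d)) (sym p)))
    select : ∀ x → Σ< (suc n) (λ u → δ (d * x) u * (F x * g (n ∸ u))) ≡ ι≤ (d * x) n * (F x * g (n ∸ d * x))
    select x with d * x ≤? n
    ... | yes p = trans (Σ-δ (suc n) (d * x) (λ u → F x * g (n ∸ u)) (s≤s p))
                        (sym (trans (cong (_* (F x * g (n ∸ d * x))) (ind-yes (d * x ≤? n) p)) (+-identityʳ _)))
    ... | no p = trans (Σ-δ-out (suc n) (d * x) (λ u → F x * g (n ∸ u)) (≰⇒> p))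
                       (sym (cong (_* (F x * g (n ∸ d * x))) (ind-no (d * x ≤? n) p)))

-- A weight w gives, for every part
-- size j, a series w j in the multiplicity m; the part j contributes the
-- factor Σ_m w j m q^{jm} = (w j)(q^j), and Π⋆ w j k multiplies the
-- factors of the part sizes j, …, j+k-1.
module WeightedProducts where

  open import Data.Nat
  open import Data.Nat.Properties
  open import Relation.Binary.PropositionalEquality
  open import Data.Product using (_,_)
  open PowerSeries
  open Dilation

  Weight : Set
  Weight = ℕ → Series

  factor : Weight → ℕ → Series
  factor w j = dilate j (w j)

  Π⋆ : Weight → ℕ → ℕ → Series
  Π⋆ w j zero = ε
  Π⋆ w j (suc k) = factor w j ⋆ Π⋆ w (suc j) k

  Π⋆-⋆ : ∀ (w w₁ w₂ : Weight) j' k → (∀ j → w (suc j) ≈ (w₁ (suc j) ⋆ w₂ (suc j))) →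
    Π⋆ w (suc j') k ≈ (Π⋆ w₁ (suc j') k ⋆ Π⋆ w₂ (suc j') k)
  Π⋆-⋆ w w₁ w₂ j' zero e n = sym (ε-⋆ ε n)
  Π⋆-⋆ w w₁ w₂ j' (suc k) e =
    ≈-trans (⋆-cong (≈-trans (dilate-cong (suc j') (e j')) (dilate-⋆ j' (w₁ (suc j')) (w₂ (suc j'))))
                    (Π⋆-⋆ w w₁ w₂ (suc j') k e))
            (⋆-interchange (factor w₁ (suc j')) (factor w₂ (suc j')) (Π⋆ w₁ (2+ j') k) (Π⋆ w₂ (2+ j') k))

  Π⋆-dilate : ∀ r' (w : Weight) j' k → Π⋆ (λ j → dilate (suc r') (w j)) (suc j') k ≈ dilate (suc r') (Π⋆ w (suc j') k)
  Π⋆-dilate r' w j' zero = ≈-sym (dilate-ε r')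
  Π⋆-dilate r' w j' (suc k) =
    ≈-trans (⋆-cong dilates-commute (Π⋆-dilate r' w (suc j') k))
            (≈-sym (dilate-⋆ r' (factor w (suc j')) (Π⋆ w (2+ j') k)))
    where
    dilates-commute : dilate (suc j') (dilate (suc r') (w (suc j'))) ≈ dilate (suc r') (dilate (suc j') (w (suc j')))
    dilates-commute = ≈-trans (≈-sym (dilate-dilate j' r' (w (suc j'))))
                      (≈-trans (λ n → cong (λ q → dilate q (w (suc j')) n) (*-comm (suc j') (suc r')))
                               (dilate-dilate r' j' (w (suc j'))))

  Π⋆-snoc : ∀ w j k → Π⋆ w j (suc k) ≈ (Π⋆ w j k ⋆ factor w (j + k))
  Π⋆-snoc w j zero =
    ≈-trans (⋆-cong (λ n → cong (λ i → factor w i n) (sym (+-identityʳ j))) (≈-refl {ε})) (⋆-comm (factor w (j + 0)) ε)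
  Π⋆-snoc w j (suc k) =
    ≈-trans (⋆-congʳ (factor w j) (≈-trans (Π⋆-snoc w (suc j) k)
              (⋆-congʳ (Π⋆ w (suc j) k) (λ n → cong (λ i → factor w i n) (sym (+-suc j k))))))
            (≈-sym (⋆-assoc (factor w j) (Π⋆ w (suc j) k) (factor w (j + suc k))))

  Π⋆-stable : ∀ (w : Weight) a b N → (∀ j → w j 0 ≡ 1) → N ≤ a → N ≤ b → Π⋆ w 1 a ≈[ N ] Π⋆ w 1 b
  Π⋆-stable w a b N w0 N≤a N≤b x x≤N = trans (toN a N≤a) (sym (toN b N≤b))
    where
    factor≈ε : ∀ k → N < suc k → factor w (suc k) ≈[ N ] ε
    factor≈ε k N<k m m≤N = trans (dilate-low k (w (suc k)) m (≤-<-trans m≤N N<k)) (trans (cong (ε m *_) (w0 _)) (*-identityʳ _))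
    step : ∀ k → N ≤ k → Π⋆ w 1 (suc k) ≈[ N ] Π⋆ w 1 k
    step k N≤k n n≤N = trans (Π⋆-snoc w 1 k n)
                       (trans (⋆-cong≤ {Π⋆ w 1 k} N (λ _ _ → refl) (factor≈ε k (s≤s N≤k)) n n≤N) (⋆-ε (Π⋆ w 1 k) n))
    toN : ∀ k → N ≤ k → Π⋆ w 1 k x ≡ Π⋆ w 1 N x
    toN k N≤k with m≤n⇒∃[o]m+o≡n N≤k
    ... | c , refl = go c
      where
      go : ∀ c → Π⋆ w 1 (N + c) x ≡ Π⋆ w 1 N x
      go zero = cong (λ k → Π⋆ w 1 k x) (+-identityʳ N)
      go (suc c) = trans (cong (λ k → Π⋆ w 1 k x) (+-suc N c)) (trans (step (N + c) (m≤m+n N c) x x≤N) (go c))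

module PartitionSeries where

  open import Data.Nat
  open import Data.Nat.Properties
  open import Data.Nat.Divisibility using (_∣_; divides)
  open import Relation.Binary.PropositionalEquality
  open import Relation.Nullary using (¬_; yes; no)
  open import Data.Empty using (⊥-elim)
  open ≡-Reasoning
  open Sums
  open PowerSeries
  open Dilation
  open WeightedProducts

  ones : Series
  ones _ = 1

  once : Series
  once zero = 1
  once (suc zero) = 1
  once (suc (suc _)) = 0

  under : ℕ → Series
  under r m = ι≤ (suc m) r

  partitions≤ : ℕ → Series
  partitions≤ i = Π⋆ (λ _ → ones) 1 i

  distinct≤ : ℕ → Series
  distinct≤ K = Π⋆ (λ _ → once) 1 K

  ones-dilate : ∀ d' → dilate (suc d') ones ≈ (ε ⊕ shift (suc d') (dilate (suc d') ones))
  ones-dilate d' = ≈-sym (dilate-unique d' (ε ⊕ shift d G) ones at off)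
    where
    d = suc d'
    G = dilate d ones
    at : ∀ x → (ε ⊕ shift d G) (d * x) ≡ 1
    at zero = cong (ε ⊕ shift d G) (*-zeroʳ d)
    at (suc x) = trans (cong (ε ⊕ shift d G) (*-suc d x))
                       (trans (cong (ε (d + d * x) +_) (shift-high d G (d * x))) (dilate-at d' ones x))
    off : ∀ n → ¬ (d ∣ n) → (ε ⊕ shift d G) n ≡ 0
    off zero nd = ⊥-elim (nd (divides 0 refl))
    off (suc n) nd with suc n <? d
    ... | yes lt = shift-low d G (suc n) lt
    ... | no ge = trans (shift-≤ d G (≮⇒≥ ge)) (dilate-off d ones _ (λ p → nd (subst (d ∣_) (m+[n∸m]≡n (≮⇒≥ ge)) (plus-d p))))
      where
      plus-d : d ∣ (suc n ∸ d) → d ∣ d + (suc n ∸ d)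
      plus-d (divides q e) = divides (suc q) (cong (d +_) e)

  once-dilate : ∀ d' → dilate (suc d') once ≈ (ε ⊕ shift (suc d') ε)
  once-dilate d' = ≈-sym (dilate-unique d' (ε ⊕ shift d ε) once at off)
    where
    d = suc d'
    at : ∀ x → (ε ⊕ shift d ε) (d * x) ≡ once x
    at zero = cong (ε ⊕ shift d ε) (*-zeroʳ d)
    at (suc zero) = trans (cong (ε ⊕ shift d ε) (trans (*-identityʳ d) (sym (+-identityʳ d)))) (shift-high d ε 0)
    at (suc (suc x)) = trans (cong (ε ⊕ shift d ε) (*-suc d (suc x))) (trans (shift-high d ε (d * suc x)) (cong ε (*-suc d x)))
    off : ∀ n → ¬ (d ∣ n) → (ε ⊕ shift d ε) n ≡ 0
    off zero nd = ⊥-elim (nd (divides 0 refl))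
    off (suc n) nd with suc n <? d
    ... | yes lt = shift-low d ε (suc n) lt
    ... | no ge = trans (shift-≤ d ε (≮⇒≥ ge)) (ε-off (suc n ∸ d) refl)
      where
      ε-off : ∀ m → m ≡ suc n ∸ d → ε m ≡ 0
      ε-off zero p = ⊥-elim (nd (divides 1 (trans (sym (m+[n∸m]≡n (≮⇒≥ ge)))
                        (trans (cong (d +_) (sym p)) (trans (+-identityʳ d) (sym (*-identityˡ d)))))))
      ε-off (suc m) p = refl

  partitions≤-rec : ∀ i → partitions≤ (suc i) ≈ (partitions≤ i ⊕ shift (suc i) (partitions≤ (suc i)))
  partitions≤-rec i n = begin
    partitions≤ (suc i) n                                 ≡⟨ Π⋆-snoc (λ _ → ones) 1 i n ⟩
    (P ⋆ G) n                                              ≡⟨ ⋆-congʳ P (ones-dilate i) n ⟩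
    (P ⋆ (ε ⊕ shift (suc i) G)) n                          ≡⟨ ⋆-distribˡ P ε _ n ⟩
    (P ⋆ ε) n + (P ⋆ shift (suc i) G) n                    ≡⟨ cong₂ _+_ (⋆-ε P n) (⋆-shift (suc i) P G n) ⟩
    P n + shift (suc i) (P ⋆ G) n                          ≡⟨ cong (P n +_) (shift-cong (suc i) (λ m → sym (Π⋆-snoc (λ _ → ones) 1 i m)) n) ⟩
    P n + shift (suc i) (partitions≤ (suc i)) n            ∎
    where
    P = partitions≤ i
    G = dilate (suc i) ones

  partitions≤-0 : ∀ i → partitions≤ i 0 ≡ 1
  partitions≤-0 zero = refl
  partitions≤-0 (suc i) = trans (partitions≤-rec i 0) (trans (+-identityʳ _) (partitions≤-0 i))

  distinct≤-rec : ∀ K → distinct≤ (suc K) ≈ (distinct≤ K ⊕ shift (suc K) (distinct≤ K))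
  distinct≤-rec K n = begin
    distinct≤ (suc K) n                        ≡⟨ Π⋆-snoc (λ _ → once) 1 K n ⟩
    (U ⋆ dilate (suc K) once) n                ≡⟨ ⋆-congʳ U (once-dilate K) n ⟩
    (U ⋆ (ε ⊕ shift (suc K) ε)) n              ≡⟨ ⋆-distribˡ U ε _ n ⟩
    (U ⋆ ε) n + (U ⋆ shift (suc K) ε) n        ≡⟨ cong₂ _+_ (⋆-ε U n) (trans (⋆-shift (suc K) U ε n) (shift-cong (suc K) (⋆-ε U) n)) ⟩
    U n + shift (suc K) U n                    ∎
    where
    U = distinct≤ K

-- subsets L i s = number of i-element subsets of {1,…,L} with sum s
-- (s ∈ ℤ so that sums may be shifted freely), i.e. the coefficients of
-- Π_{j=1}^{L} (1 + z q^j).  The defining recursion removes the element 1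
-- (if present) and lowers all others by one; subsets-largest is the
-- recursion that removes the element L+1 instead.
module SubsetSums where

  open import Data.Nat as N using (ℕ; zero; suc; _<_; s≤s)
  import Data.Nat.Properties as NP
  open import Data.Integer as Z using (ℤ; +_; -[1+_])
  import Data.Integer.Properties as ZP
  open import Data.Integer.Tactic.RingSolver
  open import Relation.Binary.PropositionalEquality
  open ≡-Reasoning
  open Sums
  open PowerSeries

  tri : ℕ → ℕ
  tri zero = 0
  tri (suc i) = suc i N.+ tri i

  atℤ : Series → ℤ → ℕ
  atℤ f (+ n) = f n
  atℤ f -[1+ _ ] = 0

  atℤ-⊕ : ∀ f g z → atℤ (f ⊕ g) z ≡ atℤ f z N.+ atℤ g z
  atℤ-⊕ f g (+ n) = refl
  atℤ-⊕ f g -[1+ n ] = refl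

  atℤ-shift : ∀ d f z → atℤ (shift d f) z ≡ atℤ f (z Z.- + d)
  atℤ-shift zero f z = cong (atℤ f) (sym (ZP.+-identityʳ z))
  atℤ-shift (suc d) f (+ zero) = refl
  atℤ-shift (suc d) f (+ suc m) = trans (atℤ-shift d f (+ m)) (cong (atℤ f) (sym (lower (+ m) (+ d))))
    where
    lower : ∀ (a b : ℤ) → Z.+ 1 Z.+ a Z.- (Z.+ 1 Z.+ b) ≡ a Z.- b
    lower = solve-∀
  atℤ-shift (suc d) f -[1+ k ] = refl

  subsets : ℕ → ℕ → ℤ → ℕ
  subsets zero zero (+ zero) = 1
  subsets zero zero (+ suc _) = 0
  subsets zero zero -[1+ _ ] = 0
  subsets zero (suc i) s = 0
  subsets (suc L) zero s = subsets L zero s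
  subsets (suc L) (suc i) s = subsets L (suc i) (s Z.- + suc i) N.+ subsets L i (s Z.- + suc i)

  subsets-empty : ∀ L s → subsets L 0 s ≡ atℤ ε s
  subsets-empty zero (+ zero) = refl
  subsets-empty zero (+ suc n) = refl
  subsets-empty zero -[1+ n ] = refl
  subsets-empty (suc L) s = subsets-empty L s

  subsets-tooMany : ∀ L i s → L < i → subsets L i s ≡ 0
  subsets-tooMany zero (suc i) s _ = refl
  subsets-tooMany (suc L) (suc i) s (s≤s L<i) =
    cong₂ N._+_ (subsets-tooMany L (suc i) _ (NP.m<n⇒m<1+n L<i)) (subsets-tooMany L i _ L<i)

  subsets-small : ∀ L i s → s Z.< + tri i → subsets L i s ≡ 0
  subsets-small zero zero (+ zero) (Z.+<+ ())
  subsets-small zero zero (+ suc n) (Z.+<+ ())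
  subsets-small zero zero -[1+ n ] _ = refl
  subsets-small zero (suc i) s _ = refl
  subsets-small (suc L) zero s lt = subsets-small L zero s lt
  subsets-small (suc L) (suc i) s lt =
    cong₂ N._+_ (subsets-small L (suc i) _ (ZP.≤-<-trans (ZP.i-j≤i s (+ suc i)) lt))
                (subsets-small L i _ (subst (s Z.- + suc i Z.<_) (cancel (+ suc i) (+ tri i)) (ZP.+-monoˡ-< (Z.- + suc i) lt)))
    where
    cancel : ∀ (a b : ℤ) → (a Z.+ b) Z.- a ≡ b
    cancel = solve-∀

  subsets-all : ∀ L s → subsets L L s ≡ atℤ ε (s Z.- + tri L)
  subsets-all zero s = trans (subsets-empty zero s) (cong (atℤ ε) (sym (ZP.+-identityʳ s)))
  subsets-all (suc L) s = begin
    subsets L (suc L) (s Z.- + suc L) N.+ subsets L L (s Z.- + suc L)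
      ≡⟨ cong (N._+ subsets L L (s Z.- + suc L)) (subsets-tooMany L (suc L) _ (NP.n<1+n L)) ⟩
    subsets L L (s Z.- + suc L)              ≡⟨ subsets-all L _ ⟩
    atℤ ε (s Z.- + suc L Z.- + tri L)        ≡⟨ cong (atℤ ε) (assoc s (+ suc L) (+ tri L)) ⟩
    atℤ ε (s Z.- + tri (suc L))              ∎
    where
    assoc : ∀ (s a b : ℤ) → s Z.- a Z.- b ≡ s Z.- (a Z.+ b)
    assoc = solve-∀

  subsets-largest : ∀ L i s → subsets (suc L) (suc i) s ≡ subsets L (suc i) s N.+ subsets L i (s Z.- + suc L)
  subsets-largest zero zero s = refl
  subsets-largest zero (suc i) s = refl
  subsets-largest (suc L) zero s = begin
    subsets (suc L) 1 (s Z.- + 1) N.+ subsets L 0 (s Z.- + 1)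
      ≡⟨ cong (N._+ subsets L 0 (s Z.- + 1)) (subsets-largest L 0 (s Z.- + 1)) ⟩
    subsets L 1 (s Z.- + 1) N.+ subsets L 0 (s Z.- + 1 Z.- + suc L) N.+ subsets L 0 (s Z.- + 1)
      ≡⟨ cong (λ x → subsets L 1 (s Z.- + 1) N.+ subsets L 0 x N.+ subsets L 0 (s Z.- + 1)) (reorder s (+ L)) ⟩
    subsets L 1 (s Z.- + 1) N.+ subsets L 0 (s Z.- + suc (suc L)) N.+ subsets L 0 (s Z.- + 1)
      ≡⟨ swap₂₃ (subsets L 1 (s Z.- + 1)) _ _ ⟩
    subsets L 1 (s Z.- + 1) N.+ subsets L 0 (s Z.- + 1) N.+ subsets L 0 (s Z.- + suc (suc L)) ∎
    where
    reorder : ∀ (s L : ℤ) → s Z.- Z.+ 1 Z.- (Z.+ 1 Z.+ L) ≡ s Z.- (Z.+ 1 Z.+ (Z.+ 1 Z.+ L))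
    reorder = solve-∀
    swap₂₃ : ∀ a b c → a N.+ b N.+ c ≡ a N.+ c N.+ b
    swap₂₃ a b c = trans (NP.+-assoc a b c) (trans (cong (a N.+_) (NP.+-comm b c)) (sym (NP.+-assoc a c b)))
  subsets-largest (suc L) (suc i) s = begin
    subsets (suc L) (suc (suc i)) s' N.+ subsets (suc L) (suc i) s'
      ≡⟨ cong₂ N._+_ (subsets-largest L (suc i) s') (subsets-largest L i s') ⟩
    subsets L (suc (suc i)) s' N.+ subsets L (suc i) (s' Z.- + suc L)
      N.+ (subsets L (suc i) s' N.+ subsets L i (s' Z.- + suc L))
      ≡⟨ +-interchange (subsets L (suc (suc i)) s') _ _ _ ⟩
    subsets L (suc (suc i)) s' N.+ subsets L (suc i) s'
      N.+ (subsets L (suc i) (s' Z.- + suc L) N.+ subsets L i (s' Z.- + suc L))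
      ≡⟨ cong (λ x → subsets L (suc (suc i)) s' N.+ subsets L (suc i) s' N.+ (subsets L (suc i) x N.+ subsets L i x))
              (reorder s (+ i) (+ L)) ⟩
    subsets L (suc (suc i)) s' N.+ subsets L (suc i) s'
      N.+ (subsets L (suc i) (s Z.- + suc (suc L) Z.- + suc i) N.+ subsets L i (s Z.- + suc (suc L) Z.- + suc i)) ∎
    where
    s' = s Z.- + suc (suc i)
    reorder : ∀ (s i L : ℤ) → s Z.- (Z.+ 1 Z.+ (Z.+ 1 Z.+ i)) Z.- (Z.+ 1 Z.+ L) ≡ s Z.- (Z.+ 1 Z.+ (Z.+ 1 Z.+ L)) Z.- (Z.+ 1 Z.+ i)
    reorder = solve-∀

  subsets-pred : ℕ → ℕ → ℤ → ℕ
  subsets-pred L zero t = 0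
  subsets-pred L (suc i) t = subsets L i t

  subsets-smallest′ : ∀ L i s → subsets (suc L) i s ≡ subsets L i (s Z.- + i) N.+ subsets-pred L i (s Z.- + i)
  subsets-smallest′ L zero s = trans (cong (subsets L 0) (sym (ZP.+-identityʳ s))) (sym (NP.+-identityʳ _))
  subsets-smallest′ L (suc i) s = refl

  subsets-largest′ : ∀ L i s → subsets (suc L) i s ≡ subsets L i s N.+ subsets-pred L i (s Z.- + suc L)
  subsets-largest′ L zero s = sym (NP.+-identityʳ _)
  subsets-largest′ L (suc i) s = subsets-largest L i s

-- A finite Jacobi triple product.  twisted L K n = Σ_i subsets L i (n + K·i)
-- is the coefficient of q^n in Π_{j=1}^{L} (1 + q^{j-K}).  For L = 2K this
-- product equals q^{-T(K-1)} · symProd K, where symProd K = Π_{j=0}^{K-1}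
-- (1+q^j) · Π_{j=1}^{K} (1+q^j), i.e. 2·(-q;q)_K·(-q;q)_{K-1} for K ≥ 1.
module TripleProduct where

  open import Data.Nat as N using (ℕ; zero; suc; _∸_)
  import Data.Nat.Properties as NP
  open import Data.Integer as Z using (ℤ; +_)
  import Data.Integer.Properties as ZP
  open import Data.Integer.Tactic.RingSolver
  open import Data.Nat.Tactic.RingSolver as ℕ-Solver using ()
  open import Relation.Binary.PropositionalEquality
  open ≡-Reasoning
  open Sums
  open PowerSeries
  open PartitionSeries
  open SubsetSums

  twisted : ℕ → ℕ → ℤ → ℕ
  twisted L K n = Σ< (suc L) (λ i → subsets L i (n Z.+ + (K N.* i)))

  Σ-subsets-truncate : ∀ L c (φ : ℕ → ℤ) → Σ< (c N.+ suc L) (λ i → subsets L i (φ i)) ≡ Σ< (suc L) (λ i → subsets L i (φ i))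
  Σ-subsets-truncate L c φ =
    sym (Σ-extend (suc L) (c N.+ suc L) _ (NP.m≤n+m (suc L) c) (λ i L<i _ → subsets-tooMany L i (φ i) L<i))

  +K* : ∀ K i → + (K N.* i) ≡ + K Z.* + i
  +K* K i = ZP.pos-* K i

  -- An i-subset of {1,…,2K+2}
  -- either avoids both 1 and 2K+2, or contains 1 but not 2K+2, or contains
  -- 2K+2; removing these elements and lowering the rest by one gives the
  -- four terms of  (1+q^{-K})(1+q^{K+1}) Π_{j=1}^{2K} (1+q^{j-K}).
  module TwistedStep (K : ℕ) (n : ℤ) where

    L LL : ℕ
    L = K N.+ K
    LL = suc (suc L)

    s : ℕ → ℤ
    s i = n Z.+ + (suc K N.* i)

    avoid-ends first-only with-last : ℕ → ℕ
    avoid-ends i = subsets L i (s i Z.- + i)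
    first-only i = subsets-pred L i (s i Z.- + i)
    with-last i = subsets-pred (suc L) i (s i Z.- + LL)

    split : ∀ i → subsets LL i (s i) ≡ avoid-ends i N.+ (first-only i N.+ with-last i)
    split i = trans (subsets-largest′ (suc L) i (s i))
                    (trans (cong (N._+ with-last i) (subsets-smallest′ L i (s i))) (NP.+-assoc (avoid-ends i) _ _))

    Σ-avoid-ends : Σ< (suc LL) avoid-ends ≡ twisted L K n
    Σ-avoid-ends = trans (Σ-subsets-truncate L 2 (λ i → s i Z.- + i)) (Σ-cong (suc L) (λ i _ → cong (subsets L i) (index i)))
      where
      alg : ∀ (n i k : ℤ) → n Z.+ (Z.+ 1 Z.+ k) Z.* i Z.- i ≡ n Z.+ k Z.* i
      alg = solve-∀
      index : ∀ i → s i Z.- + i ≡ n Z.+ + (K N.* i)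
      index i = trans (cong (λ x → n Z.+ x Z.- + i) (ZP.pos-* (suc K) i)) (trans (alg n (+ i) (+ K)) (cong (λ x → n Z.+ x) (sym (+K* K i))))

    Σ-first-only : Σ< (suc LL) first-only ≡ twisted L K (n Z.+ + K)
    Σ-first-only = trans (Σ-subsets-truncate L 1 (λ i → s (suc i) Z.- + suc i)) (Σ-cong (suc L) (λ i _ → cong (subsets L i) (index i)))
      where
      alg : ∀ (n i k : ℤ) → n Z.+ (Z.+ 1 Z.+ k) Z.* (Z.+ 1 Z.+ i) Z.- (Z.+ 1 Z.+ i) ≡ n Z.+ k Z.+ k Z.* i
      alg = solve-∀
      index : ∀ i → s (suc i) Z.- + suc i ≡ n Z.+ + K Z.+ + (K N.* i)
      index i = trans (cong (λ x → n Z.+ x Z.- + suc i) (ZP.pos-* (suc K) (suc i))) (trans (alg n (+ i) (+ K)) (cong (λ x → n Z.+ + K Z.+ x) (sym (+K* K i))))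

    Σ-with-last : Σ< (suc LL) with-last ≡ twisted L K (n Z.- + suc K) N.+ twisted L K (n Z.- + 1)
    Σ-with-last = begin
      Σ< LL (λ i → subsets (suc L) i (t i))
        ≡⟨ Σ-cong LL (λ i _ → subsets-smallest′ L i (t i)) ⟩
      Σ< LL (λ i → subsets L i (t i Z.- + i) N.+ subsets-pred L i (t i Z.- + i))
        ≡⟨ Σ-+ LL (λ i → subsets L i (t i Z.- + i)) (λ i → subsets-pred L i (t i Z.- + i)) ⟩
      Σ< LL (λ i → subsets L i (t i Z.- + i)) N.+ Σ< (suc L) (λ i → subsets L i (t (suc i) Z.- + suc i))
        ≡⟨ cong₂ N._+_ (trans (Σ-subsets-truncate L 1 (λ i → t i Z.- + i)) (Σ-cong (suc L) (λ i _ → cong (subsets L i) (index₁ i))))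
                       (Σ-cong (suc L) (λ i _ → cong (subsets L i) (index₂ i))) ⟩
      twisted L K (n Z.- + suc K) N.+ twisted L K (n Z.- + 1) ∎
      where
      -- the sum left after removing 2K+2 from a subset of size i+1
      t : ℕ → ℤ
      t i = s (suc i) Z.- + LL
      alg₁ : ∀ (n i k : ℤ) → n Z.+ (Z.+ 1 Z.+ k) Z.* (Z.+ 1 Z.+ i) Z.- (Z.+ 1 Z.+ (Z.+ 1 Z.+ (k Z.+ k))) Z.- i ≡ n Z.- (Z.+ 1 Z.+ k) Z.+ k Z.* i
      alg₁ = solve-∀
      alg₂ : ∀ (n i k : ℤ) → n Z.+ (Z.+ 1 Z.+ k) Z.* (Z.+ 1 Z.+ (Z.+ 1 Z.+ i)) Z.- (Z.+ 1 Z.+ (Z.+ 1 Z.+ (k Z.+ k))) Z.- (Z.+ 1 Z.+ i) ≡ n Z.- Z.+ 1 Z.+ k Z.* i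
      alg₂ = solve-∀
      index₁ : ∀ i → t i Z.- + i ≡ n Z.- + suc K Z.+ + (K N.* i)
      index₁ i = trans (cong (λ x → n Z.+ x Z.- + LL Z.- + i) (ZP.pos-* (suc K) (suc i)))
                       (trans (cong (λ x → n Z.+ (Z.+ 1 Z.+ + K) Z.* (Z.+ 1 Z.+ + i) Z.- (Z.+ 1 Z.+ (Z.+ 1 Z.+ x)) Z.- + i) (ZP.pos-+ K K))
                              (trans (alg₁ n (+ i) (+ K)) (cong (λ x → n Z.- + suc K Z.+ x) (sym (+K* K i)))))
      index₂ : ∀ i → t (suc i) Z.- + suc i ≡ n Z.- + 1 Z.+ + (K N.* i)
      index₂ i = trans (cong (λ x → n Z.+ x Z.- + LL Z.- + suc i) (ZP.pos-* (suc K) (suc (suc i))))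
                       (trans (cong (λ x → n Z.+ (Z.+ 1 Z.+ + K) Z.* (Z.+ 1 Z.+ (Z.+ 1 Z.+ + i)) Z.- (Z.+ 1 Z.+ (Z.+ 1 Z.+ x)) Z.- (Z.+ 1 Z.+ + i)) (ZP.pos-+ K K))
                              (trans (alg₂ n (+ i) (+ K)) (cong (λ x → n Z.- + 1 Z.+ x) (sym (+K* K i)))))

  twisted-step : ∀ K n → twisted (suc (suc (K N.+ K))) (suc K) n ≡
     twisted (K N.+ K) K n N.+ twisted (K N.+ K) K (n Z.+ + K) N.+ (twisted (K N.+ K) K (n Z.- + suc K) N.+ twisted (K N.+ K) K (n Z.- + 1))
  twisted-step K n = begin
    Σ< (suc LL) (λ i → subsets LL i (s i))
      ≡⟨ Σ-cong (suc LL) {g = λ i → avoid-ends i N.+ (first-only i N.+ with-last i)} (λ i _ → split i) ⟩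
    Σ< (suc LL) (λ i → avoid-ends i N.+ (first-only i N.+ with-last i))
      ≡⟨ trans (Σ-+ (suc LL) avoid-ends (λ i → first-only i N.+ with-last i)) (cong (Σ< (suc LL) avoid-ends N.+_) (Σ-+ (suc LL) first-only with-last)) ⟩
    Σ< (suc LL) avoid-ends N.+ (Σ< (suc LL) first-only N.+ Σ< (suc LL) with-last)
      ≡⟨ sym (NP.+-assoc (Σ< (suc LL) avoid-ends) _ _) ⟩
    Σ< (suc LL) avoid-ends N.+ Σ< (suc LL) first-only N.+ Σ< (suc LL) with-last
      ≡⟨ cong₂ N._+_ (cong₂ N._+_ Σ-avoid-ends Σ-first-only) Σ-with-last ⟩
    twisted L K n N.+ twisted L K (n Z.+ + K) N.+ (twisted L K (n Z.- + suc K) N.+ twisted L K (n Z.- + 1)) ∎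
    where open TwistedStep K n

  symProd : ℕ → Series
  symProd zero = ε
  symProd (suc K) = (shift K H ⊕ H) ⊕ (shift (K N.+ suc K) H ⊕ shift (suc K) H)
    where H = symProd K

  tri-pred : ∀ K → tri K ≡ K N.+ tri (K ∸ 1)
  tri-pred zero = refl
  tri-pred (suc K) = refl

  twisted-symProd : ∀ K n → twisted (K N.+ K) K n ≡ atℤ (symProd K) (n Z.+ + tri (K ∸ 1))
  twisted-symProd zero n = trans (NP.+-identityʳ _) (subsets-empty 0 (n Z.+ + 0))
  twisted-symProd (suc K) n = begin
    twisted (suc K N.+ suc K) (suc K) n
      ≡⟨ cong (λ L → twisted L (suc K) n) (cong suc (NP.+-suc K K)) ⟩
    twisted (suc (suc (K N.+ K))) (suc K) n
      ≡⟨ twisted-step K n ⟩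
    G n N.+ G (n Z.+ + K) N.+ (G (n Z.- + suc K) N.+ G (n Z.- + 1))
      ≡⟨ cong₂ N._+_ (cong₂ N._+_ (twisted-symProd K n) (twisted-symProd K (n Z.+ + K)))
                     (cong₂ N._+_ (twisted-symProd K (n Z.- + suc K)) (twisted-symProd K (n Z.- + 1))) ⟩
    atℤ H (n Z.+ t) N.+ atℤ H (n Z.+ + K Z.+ t) N.+ (atℤ H (n Z.- + suc K Z.+ t) N.+ atℤ H (n Z.- + 1 Z.+ t))
      ≡⟨ cong₂ N._+_ (cong₂ N._+_ (trans (cong (atℤ H) (alg₁ n (+ K) t)) (sym (atℤ-shift K H m))) (cong (atℤ H) (alg₂ n (+ K) t)))
                     (cong₂ N._+_ (trans (cong (atℤ H) (alg₃ n (+ K) t)) (sym (atℤ-shift (K N.+ suc K) H m)))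
                                  (trans (cong (atℤ H) (alg₄ n (+ K) t)) (sym (atℤ-shift (suc K) H m)))) ⟩
    atℤ (shift K H) m N.+ atℤ H m N.+ (atℤ (shift (K N.+ suc K) H) m N.+ atℤ (shift (suc K) H) m)
      ≡⟨ sym (trans (atℤ-⊕ (shift K H ⊕ H) _ m) (cong₂ N._+_ (atℤ-⊕ (shift K H) H m) (atℤ-⊕ (shift (K N.+ suc K) H) (shift (suc K) H) m))) ⟩
    atℤ (symProd (suc K)) m
      ≡⟨ cong (λ x → atℤ (symProd (suc K)) (n Z.+ + x)) (sym (tri-pred K)) ⟩
    atℤ (symProd (suc K)) (n Z.+ + tri K) ∎
    where
    G = twisted (K N.+ K) K
    H = symProd K
    t = + tri (K ∸ 1)
    m = n Z.+ (+ K Z.+ t)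
    alg₁ : ∀ (n k t : ℤ) → n Z.+ t ≡ n Z.+ (k Z.+ t) Z.- k
    alg₁ = solve-∀
    alg₂ : ∀ (n k t : ℤ) → n Z.+ k Z.+ t ≡ n Z.+ (k Z.+ t)
    alg₂ = solve-∀
    alg₃ : ∀ (n k t : ℤ) → n Z.- (Z.+ 1 Z.+ k) Z.+ t ≡ n Z.+ (k Z.+ t) Z.- (k Z.+ (Z.+ 1 Z.+ k))
    alg₃ = solve-∀
    alg₄ : ∀ (n k t : ℤ) → n Z.- Z.+ 1 Z.+ t ≡ n Z.+ (k Z.+ t) Z.- (Z.+ 1 Z.+ k)
    alg₄ = solve-∀

  distinct-pair-rec : ∀ K → let X = distinct≤ (suc K) ⋆ distinct≤ K in
    (distinct≤ (suc (suc K)) ⋆ distinct≤ (suc K)) ≈ (X ⊕ shift (suc K) X ⊕ shift (suc (suc K)) X ⊕ shift (suc (suc K) N.+ suc K) X)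
  distinct-pair-rec K n = begin
    (distinct≤ (suc (suc K)) ⋆ distinct≤ (suc K)) n
      ≡⟨ ⋆-cong (distinct≤-rec (suc K)) (distinct≤-rec K) n ⟩
    ((A ⊕ shift (suc (suc K)) A) ⋆ (B ⊕ shift (suc K) B)) n
      ≡⟨ ⋆-distribʳ A (shift (suc (suc K)) A) _ n ⟩
    (A ⋆ (B ⊕ shift (suc K) B)) n N.+ (shift (suc (suc K)) A ⋆ (B ⊕ shift (suc K) B)) n
      ≡⟨ cong₂ N._+_ (⋆-distribˡ A B _ n) (⋆-distribˡ (shift (suc (suc K)) A) B _ n) ⟩
    (X n N.+ (A ⋆ shift (suc K) B) n) N.+ ((shift (suc (suc K)) A ⋆ B) n N.+ (shift (suc (suc K)) A ⋆ shift (suc K) B) n)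
      ≡⟨ cong₂ N._+_ (cong (X n N.+_) (⋆-shift (suc K) A B n))
                     (cong₂ N._+_ (shift-⋆ (suc (suc K)) A B n) (shift-⋆-shift (suc (suc K)) (suc K) A B n)) ⟩
    (X n N.+ shift (suc K) X n) N.+ (shift (suc (suc K)) X n N.+ shift (suc (suc K) N.+ suc K) X n)
      ≡⟨ sym (NP.+-assoc (X n N.+ shift (suc K) X n) _ _) ⟩
    X n N.+ shift (suc K) X n N.+ shift (suc (suc K)) X n N.+ shift (suc (suc K) N.+ suc K) X n ∎
    where
    A = distinct≤ (suc K)
    B = distinct≤ K
    X = A ⋆ B

  symProd-distinct : ∀ K → symProd (suc K) ≈ (λ n → 2 N.* (distinct≤ (suc K) ⋆ distinct≤ K) n)
  symProd-distinct zero n = begin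
    ε n N.+ ε n N.+ (shift 1 ε n N.+ shift 1 ε n)        ≡⟨ +-interchange (ε n) (ε n) _ _ ⟩
    ε n N.+ shift 1 ε n N.+ (ε n N.+ shift 1 ε n)        ≡⟨ sym (cong₂ N._+_ U₁ (trans (NP.+-identityʳ _) U₁)) ⟩
    2 N.* (distinct≤ 1 ⋆ distinct≤ 0) n                  ∎
    where
    U₁ : (distinct≤ 1 ⋆ distinct≤ 0) n ≡ ε n N.+ shift 1 ε n
    U₁ = trans (⋆-ε (distinct≤ 1) n) (distinct≤-rec 0 n)
  symProd-distinct (suc K) n = begin
    shift (suc K) H n N.+ H n N.+ (shift (suc K N.+ suc (suc K)) H n N.+ shift (suc (suc K)) H n)
      ≡⟨ cong₂ N._+_ (cong₂ N._+_ (doubled (suc K)) (symProd-distinct K n))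
                     (cong₂ N._+_ (trans (cong (λ e → shift e H n) (NP.+-comm (suc K) (suc (suc K)))) (doubled (suc (suc K) N.+ suc K))) (doubled (suc (suc K)))) ⟩
    2 N.* b N.+ 2 N.* a N.+ (2 N.* d N.+ 2 N.* c)
      ≡⟨ rearrange a b c d ⟩
    2 N.* (a N.+ b N.+ c N.+ d)
      ≡⟨ cong (2 N.*_) (sym (distinct-pair-rec K n)) ⟩
    2 N.* (distinct≤ (suc (suc K)) ⋆ distinct≤ (suc K)) n ∎
    where
    H = symProd (suc K)
    X = distinct≤ (suc K) ⋆ distinct≤ K
    a = X n
    b = shift (suc K) X n
    c = shift (suc (suc K)) X n
    d = shift (suc (suc K) N.+ suc K) X n
    rearrange : ∀ a b c d → 2 N.* b N.+ 2 N.* a N.+ (2 N.* d N.+ 2 N.* c) ≡ 2 N.* (a N.+ b N.+ c N.+ d)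
    rearrange = ℕ-Solver.solve-∀
    doubled : ∀ e → shift e H n ≡ 2 N.* shift e X n
    doubled e = trans (shift-cong e (symProd-distinct K) n) (twice e X n)
      where
      twice : ∀ e f m → shift e (λ x → 2 N.* f x) m ≡ 2 N.* shift e f m
      twice zero f m = refl
      twice (suc e) f zero = refl
      twice (suc e) f (suc m) = twice e f m

-- Gauss's identity  (-q;q)_∞² = Σ_j q^{T(j)} / (q;q)_∞ , coefficientwise:
-- both sides of the triple product of the previous module, for K = N+1,
-- are read off at q^N.  On the subset side, subtracting 1,…,i from the
-- elements of an i-subset of {1,…,i+b} leaves a partition into at most
-- i parts of size at most b (a Gaussian binomial coefficient), which for
-- sums ≤ b is just a partition into at most i parts.
module GaussIdentity where

  open import Data.Nat as N using (ℕ; zero; suc; _≤_; _<_; z≤n; s≤s; _∸_)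
  import Data.Nat.Properties as NP
  open import Data.Nat.Tactic.RingSolver as ℕ-Solver using ()
  open import Data.Integer as Z using (ℤ; +_; -[1+_])
  import Data.Integer.Properties as ZP
  open import Data.Integer.Tactic.RingSolver
  open import Relation.Binary.PropositionalEquality
  open import Relation.Nullary using (yes; no)
  open import Data.Empty using (⊥-elim)
  open ≡-Reasoning
  open Sums
  open PowerSeries
  open WeightedProducts
  open PartitionSeries
  open SubsetSums
  open TripleProduct

  tri-+ : ∀ a b → tri (a N.+ b) ≡ tri a N.+ tri b N.+ a N.* b
  tri-+ zero b = sym (NP.+-identityʳ (tri b))
  tri-+ (suc a) b = trans (cong (λ x → suc (a N.+ b N.+ x)) (tri-+ a b)) (alg a b (tri a) (tri b))
    where
    alg : ∀ a b ta tb → suc (a N.+ b N.+ (ta N.+ tb N.+ a N.* b)) ≡ suc (a N.+ ta) N.+ tb N.+ (b N.+ a N.* b)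
    alg = ℕ-Solver.solve-∀

  tri-double : ∀ a → tri a N.+ tri a ≡ a N.* a N.+ a
  tri-double zero = refl
  tri-double (suc a) = trans (alg₁ a (tri a)) (trans (cong (suc a N.+ suc a N.+_) (tri-double a)) (alg₂ a))
    where
    alg₁ : ∀ a ta → suc a N.+ ta N.+ (suc a N.+ ta) ≡ suc a N.+ suc a N.+ (ta N.+ ta)
    alg₁ = ℕ-Solver.solve-∀
    alg₂ : ∀ a → suc a N.+ suc a N.+ (a N.* a N.+ a) ≡ suc a N.* suc a N.+ suc a
    alg₂ = ℕ-Solver.solve-∀

  ≤-tri : ∀ j → j ≤ tri j
  ≤-tri zero = z≤n
  ≤-tri (suc j) = s≤s (NP.m≤m+n j (tri j))

  -- coefficients of the Gaussian binomial [i+b choose i], indexed by x + T(i)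
  gaussBinom : ℕ → ℕ → ℤ → ℕ
  gaussBinom i b x = subsets (i N.+ b) i (x Z.+ + tri i)

  gaussBinom-0b : ∀ b x → gaussBinom 0 b x ≡ atℤ ε x
  gaussBinom-0b b x = trans (subsets-empty b _) (cong (atℤ ε) (ZP.+-identityʳ x))

  gaussBinom-i0 : ∀ i x → gaussBinom i 0 x ≡ atℤ ε x
  gaussBinom-i0 i x = trans (cong (λ L → subsets L i (x Z.+ + tri i)) (NP.+-identityʳ i))
                            (trans (subsets-all i _) (cong (atℤ ε) (cancel x (+ tri i))))
    where
    cancel : ∀ (x t : ℤ) → x Z.+ t Z.- t ≡ x
    cancel = solve-∀

  gaussBinom-negative : ∀ i b k → gaussBinom i b -[1+ k ] ≡ 0
  gaussBinom-negative i b k = subsets-small (i N.+ b) i _ (ZP.+-monoˡ-< (+ tri i) { -[1+ k ]} {+ 0} Z.-<+)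

  gaussBinom-below : ∀ i b {x t} → x < t → gaussBinom i b (+ x Z.- + t) ≡ 0
  gaussBinom-below i b {x} {t} x<t = trans (cong (gaussBinom i b) (trans (ZP.[+m]-[+n]≡m⊖n x t) (ZP.⊖-< x<t)))
                                           (negative (t ∸ x) (NP.m>n⇒m∸n≢0 x<t))
    where
    negative : ∀ k → k ≢ 0 → gaussBinom i b (Z.- (+ k)) ≡ 0
    negative zero ne = ⊥-elim (ne refl)
    negative (suc k) _ = gaussBinom-negative i b k

  gaussBinom-pascal : ∀ i b x → gaussBinom (suc i) (suc b) x ≡ gaussBinom (suc i) b (x Z.- + suc i) N.+ gaussBinom i (suc b) x
  gaussBinom-pascal i b x = cong₂ N._+_
    (trans (cong (λ L → subsets L (suc i) (x Z.+ + tri (suc i) Z.- + suc i)) (NP.+-suc i b)) (cong (subsets (suc i N.+ b) (suc i)) (alg₁ x (+ suc i) (+ tri i))))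
    (cong (subsets (i N.+ suc b) i) (alg₂ x (+ suc i) (+ tri i)))
    where
    alg₁ : ∀ (x a t : ℤ) → x Z.+ (a Z.+ t) Z.- a ≡ x Z.- a Z.+ (a Z.+ t)
    alg₁ = solve-∀
    alg₂ : ∀ (x a t : ℤ) → x Z.+ (a Z.+ t) Z.- a ≡ x Z.+ t
    alg₂ = solve-∀

  -- for x ≤ b the bound b on the parts is irrelevant
  gaussBinom-partitions : ∀ i b x → x ≤ b → gaussBinom i b (+ x) ≡ partitions≤ i x
  gaussBinom-partitions zero b x _ = gaussBinom-0b b (+ x)
  gaussBinom-partitions (suc i) zero zero _ = trans (gaussBinom-i0 (suc i) (+ 0)) (sym (partitions≤-0 (suc i)))
  gaussBinom-partitions (suc i) (suc b) x x≤b = begin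
    gaussBinom (suc i) (suc b) (+ x)
      ≡⟨ gaussBinom-pascal i b (+ x) ⟩
    gaussBinom (suc i) b (+ x Z.- + suc i) N.+ gaussBinom i (suc b) (+ x)
      ≡⟨ cong₂ N._+_ first (gaussBinom-partitions i (suc b) x x≤b) ⟩
    shift (suc i) (partitions≤ (suc i)) x N.+ partitions≤ i x
      ≡⟨ NP.+-comm _ (partitions≤ i x) ⟩
    partitions≤ i x N.+ shift (suc i) (partitions≤ (suc i)) x
      ≡⟨ sym (partitions≤-rec i x) ⟩
    partitions≤ (suc i) x ∎
    where
    first : gaussBinom (suc i) b (+ x Z.- + suc i) ≡ shift (suc i) (partitions≤ (suc i)) x
    first with x N.<? suc i
    ... | yes lt = trans (gaussBinom-below (suc i) b lt) (sym (shift-low (suc i) _ x lt))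
    ... | no ge = begin
      gaussBinom (suc i) b (+ x Z.- + suc i)   ≡⟨ cong (gaussBinom (suc i) b) (trans (ZP.[+m]-[+n]≡m⊖n x (suc i)) (ZP.⊖-≥ (NP.≮⇒≥ ge))) ⟩
      gaussBinom (suc i) b (+ (x ∸ suc i))     ≡⟨ gaussBinom-partitions (suc i) b (x ∸ suc i) (NP.≤-trans (NP.∸-monoʳ-≤ x (s≤s z≤n)) (NP.∸-monoˡ-≤ 1 x≤b)) ⟩
      partitions≤ (suc i) (x ∸ suc i)          ≡⟨ sym (shift-≤ (suc i) _ (NP.≮⇒≥ ge)) ⟩
      shift (suc i) (partitions≤ (suc i)) x    ∎

  partitions≤-stable : ∀ a b x → x ≤ a → x ≤ b → partitions≤ a x ≡ partitions≤ b x
  partitions≤-stable a b x xa xb = Π⋆-stable (λ _ → ones) a b x (λ _ → refl) xa xb x NP.≤-refl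

  gaussBinom-at : ∀ N a b t → N ∸ t ≤ a → N ∸ t ≤ b → gaussBinom a b (+ N Z.- + t) ≡ shift t (partitions≤ N) N
  gaussBinom-at N a b t ha hb with t N.≤? N
  ... | yes t≤N = begin
    gaussBinom a b (+ N Z.- + t)   ≡⟨ cong (gaussBinom a b) (trans (ZP.[+m]-[+n]≡m⊖n N t) (ZP.⊖-≥ t≤N)) ⟩
    gaussBinom a b (+ (N ∸ t))     ≡⟨ gaussBinom-partitions a b (N ∸ t) hb ⟩
    partitions≤ a (N ∸ t)          ≡⟨ partitions≤-stable a N (N ∸ t) ha (NP.m∸n≤m N t) ⟩
    partitions≤ N (N ∸ t)          ≡⟨ sym (shift-≤ t (partitions≤ N) t≤N) ⟩
    shift t (partitions≤ N) N      ∎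
  ... | no t≰N = trans (gaussBinom-below a b (NP.≰⇒> t≰N)) (sym (shift-low t (partitions≤ N) N (NP.≰⇒> t≰N)))

  tri-doubleℤ : ∀ i → + tri i Z.+ + tri i ≡ + i Z.* + i Z.+ + i
  tri-doubleℤ i = trans (cong +_ (tri-double i)) (cong (Z._+ + i) (ZP.pos-* i i))

  twisted-term-low : ∀ i j → let N = i N.+ j in
    subsets (suc N N.+ suc N) i ((+ N Z.- + tri N) Z.+ + (suc N N.* i)) ≡ shift (tri j) (partitions≤ N) N
  twisted-term-low i j = trans (cong₂ (λ L s → subsets L i s) (alg-size i j) index) (gaussBinom-at N i (suc (suc (N N.+ j))) (tri j) h₁ h₂)
    where
    N = i N.+ j
    alg-size : ∀ i j → suc (i N.+ j) N.+ suc (i N.+ j) ≡ i N.+ suc (suc (i N.+ j N.+ j))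
    alg-size = ℕ-Solver.solve-∀
    h₁ : N ∸ tri j ≤ i
    h₁ = NP.≤-trans (NP.∸-monoʳ-≤ N (≤-tri j)) (NP.≤-reflexive (NP.m+n∸n≡m i j))
    h₂ : N ∸ tri j ≤ suc (suc (N N.+ j))
    h₂ = NP.≤-trans (NP.m∸n≤m N (tri j)) (NP.≤-trans (NP.m≤m+n N j) (NP.≤-trans (NP.n≤1+n _) (NP.n≤1+n _)))
    alg₁ : ∀ (I J Ti Tj : ℤ) → (I Z.+ J) Z.- (Ti Z.+ Tj Z.+ I Z.* J) Z.+ (Z.+ 1 Z.+ (I Z.+ J)) Z.* I
                             ≡ (I Z.+ J) Z.- Tj Z.+ Ti Z.+ ((I Z.* I Z.+ I) Z.- (Ti Z.+ Ti))
    alg₁ = solve-∀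
    alg₂ : ∀ (X A : ℤ) → X Z.+ (A Z.- A) ≡ X
    alg₂ = solve-∀
    index : (+ N Z.- + tri N) Z.+ + (suc N N.* i) ≡ (+ N Z.- + tri j) Z.+ + tri i
    index = begin
      (+ N Z.- + tri N) Z.+ + (suc N N.* i)
        ≡⟨ cong₂ (λ a b → (+ N Z.- a) Z.+ b) (trans (cong +_ (tri-+ i j)) (cong (λ x → + tri i Z.+ + tri j Z.+ x) (ZP.pos-* i j))) (ZP.pos-* (suc N) i) ⟩
      (+ i Z.+ + j) Z.- (+ tri i Z.+ + tri j Z.+ + i Z.* + j) Z.+ (Z.+ 1 Z.+ (+ i Z.+ + j)) Z.* + i
        ≡⟨ alg₁ (+ i) (+ j) (+ tri i) (+ tri j) ⟩
      (+ i Z.+ + j) Z.- + tri j Z.+ + tri i Z.+ ((+ i Z.* + i Z.+ + i) Z.- (+ tri i Z.+ + tri i))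
        ≡⟨ cong (λ x → (+ i Z.+ + j) Z.- + tri j Z.+ + tri i Z.+ ((+ i Z.* + i Z.+ + i) Z.- x)) (tri-doubleℤ i) ⟩
      (+ i Z.+ + j) Z.- + tri j Z.+ + tri i Z.+ ((+ i Z.* + i Z.+ + i) Z.- (+ i Z.* + i Z.+ + i))
        ≡⟨ alg₂ ((+ i Z.+ + j) Z.- + tri j Z.+ + tri i) (+ i Z.* + i Z.+ + i) ⟩
      (+ N Z.- + tri j) Z.+ + tri i ∎

  twisted-term-high : ∀ N m → m ≤ suc N → let K = suc N in
    subsets (K N.+ K) (K N.+ m) ((+ N Z.- + tri N) Z.+ + (K N.* (K N.+ m))) ≡ shift (tri m) (partitions≤ N) N
  twisted-term-high N m m≤K = trans (cong₂ (λ L s → subsets L (K N.+ m) s) size index) (gaussBinom-at N (K N.+ m) (K ∸ m) (tri m) h₁ h₂)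
    where
    K = suc N
    size : K N.+ K ≡ K N.+ m N.+ (K ∸ m)
    size = trans (cong (K N.+_) (sym (NP.m+[n∸m]≡n m≤K))) (sym (NP.+-assoc K m (K ∸ m)))
    h₁ : N ∸ tri m ≤ K N.+ m
    h₁ = NP.≤-trans (NP.m∸n≤m N (tri m)) (NP.≤-trans (NP.n≤1+n N) (NP.m≤m+n K m))
    h₂ : N ∸ tri m ≤ K ∸ m
    h₂ = NP.≤-trans (NP.∸-monoʳ-≤ N (≤-tri m)) (NP.∸-monoˡ-≤ m (NP.n≤1+n N))
    alg₁ : ∀ (A TN Tm Mm : ℤ) → (A Z.- TN) Z.+ (Z.+ 1 Z.+ A) Z.* ((Z.+ 1 Z.+ A) Z.+ Mm)
         ≡ (A Z.- Tm) Z.+ ((Z.+ 1 Z.+ A) Z.+ TN Z.+ Tm Z.+ (Z.+ 1 Z.+ A) Z.* Mm) Z.+ ((A Z.* A Z.+ A) Z.- (TN Z.+ TN))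
    alg₁ = solve-∀
    alg₂ : ∀ (X A : ℤ) → X Z.+ (A Z.- A) ≡ X
    alg₂ = solve-∀
    Y = (+ N Z.- + tri m) Z.+ ((Z.+ 1 Z.+ + N) Z.+ + tri N Z.+ + tri m Z.+ (Z.+ 1 Z.+ + N) Z.* + m)
    index : (+ N Z.- + tri N) Z.+ + (K N.* (K N.+ m)) ≡ (+ N Z.- + tri m) Z.+ + tri (K N.+ m)
    index = begin
      (+ N Z.- + tri N) Z.+ + (K N.* (K N.+ m))
        ≡⟨ cong (λ x → (+ N Z.- + tri N) Z.+ x) (ZP.pos-* K (K N.+ m)) ⟩
      (+ N Z.- + tri N) Z.+ (Z.+ 1 Z.+ + N) Z.* ((Z.+ 1 Z.+ + N) Z.+ + m)
        ≡⟨ alg₁ (+ N) (+ tri N) (+ tri m) (+ m) ⟩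
      Y Z.+ ((+ N Z.* + N Z.+ + N) Z.- (+ tri N Z.+ + tri N))
        ≡⟨ cong (λ x → Y Z.+ ((+ N Z.* + N Z.+ + N) Z.- x)) (tri-doubleℤ N) ⟩
      Y Z.+ ((+ N Z.* + N Z.+ + N) Z.- (+ N Z.* + N Z.+ + N))
        ≡⟨ alg₂ Y (+ N Z.* + N Z.+ + N) ⟩
      Y
        ≡⟨ cong (λ x → (+ N Z.- + tri m) Z.+ x) (sym (trans (cong +_ (tri-+ K m)) (cong (λ y → + tri K Z.+ + tri m Z.+ y) (ZP.pos-* K m)))) ⟩
      (+ N Z.- + tri m) Z.+ + tri (K N.+ m) ∎

  gauss : ∀ N → (distinct≤ (suc N) ⋆ distinct≤ N) N ≡ Σ< (suc N) (λ j → shift (tri j) (partitions≤ N) N)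
  gauss N = NP.*-cancelˡ-≡ _ _ 2 (begin
    2 N.* X                                     ≡⟨ sym (symProd-distinct N N) ⟩
    symProd K N                                 ≡⟨ cong (atℤ (symProd K)) (sym (alg (+ N) (+ tri N))) ⟩
    atℤ (symProd K) (n Z.+ + tri N)             ≡⟨ sym (twisted-symProd K n) ⟩
    twisted (K N.+ K) K n                       ≡⟨ cong (λ L → Σ< L F) (sym (NP.+-suc K K)) ⟩
    Σ< (K N.+ suc K) F                          ≡⟨ Σ-split K (suc K) F ⟩
    Σ< K F N.+ Σ< (suc K) (λ m → F (K N.+ m))   ≡⟨ cong₂ N._+_ low high ⟩
    Sf N.+ Sf                                   ≡⟨ cong (Sf N.+_) (sym (NP.+-identityʳ Sf)) ⟩
    2 N.* Sf                                    ∎)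
    where
    K = suc N
    X = (distinct≤ K ⋆ distinct≤ N) N
    f : ℕ → ℕ
    f j = shift (tri j) (partitions≤ N) N
    Sf = Σ< (suc N) f
    n = + N Z.- + tri N
    F : ℕ → ℕ
    F i = subsets (K N.+ K) i (n Z.+ + (K N.* i))
    alg : ∀ (a b : ℤ) → a Z.- b Z.+ b ≡ a
    alg = solve-∀
    low : Σ< K F ≡ Sf
    low = trans (Σ-rev K F) (Σ-cong K (λ j j<K → subst (λ Y → subsets (suc Y N.+ suc Y) (N ∸ j) ((+ Y Z.- + tri Y) Z.+ + (suc Y N.* (N ∸ j))) ≡ shift (tri j) (partitions≤ Y) Y)
                                                     (NP.m∸n+n≡m (NP.≤-pred j<K)) (twisted-term-low (N ∸ j) j)))
    high : Σ< (suc K) (λ m → F (K N.+ m)) ≡ Sf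
    high = begin
      Σ< (suc K) (λ m → F (K N.+ m)) ≡⟨ Σ-cong (suc K) (λ m m<sK → twisted-term-high N m (NP.≤-pred m<sK)) ⟩
      Σ< (suc K) f                   ≡⟨ Σ-last K f ⟩
      Sf N.+ f K                     ≡⟨ cong (Sf N.+_) (shift-low (tri K) (partitions≤ N) N (NP.≤-trans (NP.n<1+n N) (≤-tri K))) ⟩
      Sf N.+ 0                       ≡⟨ NP.+-identityʳ Sf ⟩
      Sf                             ∎

-- Splitting off  Π_j (1 + q^j + … + q^{j(r-1)}):  both sides of the theorem
-- are this product times a series in q^r.
module Factorizations where

  open import Data.Nat
  open import Data.Nat.Properties
  open import Data.Nat.Divisibility
  open import Relation.Binary.PropositionalEquality
  open import Relation.Nullary using (yes; no; ¬_)
  open import Data.Empty using (⊥-elim)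
  open ≡-Reasoning
  open Defs using (distinctDivBy?; atMost?)
  open Sums
  open PowerSeries
  open Dilation
  open WeightedProducts
  open PartitionSeries

  distinctDiv : ℕ → Weight
  distinctDiv r j m = ind (distinctDivBy? r j m)

  atMost : ℕ → Weight
  atMost r j m = ind (atMost? r j m)

  underProd : ℕ → ℕ → Series
  underProd r k = Π⋆ (λ _ → under r) 1 k

  Π⋆-skip : ∀ w c j k → (∀ i → i < c → factor w (j + i) ≈ ε) → Π⋆ w j (c + k) ≈ Π⋆ w (j + c) k
  Π⋆-skip w zero j k h n = cong (λ q → Π⋆ w q k n) (sym (+-identityʳ j))
  Π⋆-skip w (suc c) j k h =
    ≈-trans (⋆-cong first (≈-refl {Π⋆ w (suc j) (c + k)}))
    (≈-trans (ε-⋆ _)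
    (≈-trans (Π⋆-skip w c (suc j) k (λ i i<c → ≈-trans (λ n → cong (λ q → factor w q n) (sym (+-suc j i))) (h (suc i) (s≤s i<c))))
             (λ n → cong (λ q → Π⋆ w q k n) (sym (+-suc j c)))))
    where
    first : factor w j ≈ ε
    first = ≈-trans (λ n → cong (λ q → factor w q n) (sym (+-identityʳ j))) (h 0 (s≤s z≤n))

  Π⋆-multiples : ∀ r' (w v : Weight) → (∀ i → ¬ (suc r' ∣ i) → factor w i ≈ ε) →
    (∀ t → factor w (suc r' * suc t) ≈ dilate (suc r') (factor v (suc t))) →
    ∀ t f → Π⋆ w (suc r' * suc t) (suc r' * f) ≈ dilate (suc r') (Π⋆ v (suc t) f)
  Π⋆-multiples r' w v off on t zero n =
    trans (cong (λ q → Π⋆ w (suc r' * suc t) q n) (*-zeroʳ (suc r'))) (sym (dilate-ε r' n))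
  Π⋆-multiples r' w v off on t (suc f) n = begin
    Π⋆ w j (r * suc f) n                                   ≡⟨ cong (λ q → Π⋆ w j q n) (*-suc r f) ⟩
    (factor w j ⋆ Π⋆ w (suc j) (r' + r * f)) n             ≡⟨ ⋆-cong (on t) rest n ⟩
    (dilate r (factor v (suc t)) ⋆ dilate r (Π⋆ v (2+ t) f)) n ≡⟨ sym (dilate-⋆ r' (factor v (suc t)) (Π⋆ v (2+ t) f) n) ⟩
    dilate r (Π⋆ v (suc t) (suc f)) n                      ∎
    where
    r = suc r'
    j = r * suc t
    between : ∀ i → i < r' → factor w (suc j + i) ≈ ε
    between i i<r' = off (suc j + i) (λ p → <⇒≱ (s≤s i<r') (∣⇒≤ (∣m+n∣m⇒∣n (subst (r ∣_) (sym (+-suc j i)) p) (m∣m*n (suc t)))))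
    next : suc j + r' ≡ r * suc (suc t)
    next = trans (sym (+-suc j r')) (trans (+-comm j r) (sym (*-suc r (suc t))))
    rest : Π⋆ w (suc j) (r' + r * f) ≈ dilate r (Π⋆ v (2+ t) f)
    rest = ≈-trans (Π⋆-skip w r' (suc j) (r * f) between)
           (≈-trans (λ m → cong (λ q → Π⋆ w q (r * f) m) next) (Π⋆-multiples r' w v off on (suc t) f))

  Π⋆-multiples-from-1 : ∀ r' (w v : Weight) → (∀ i → ¬ (suc r' ∣ i) → factor w i ≈ ε) →
    (∀ t → factor w (suc r' * suc t) ≈ dilate (suc r') (factor v (suc t))) →
    ∀ n → Π⋆ w 1 (r' + suc r' * n) ≈ dilate (suc r') (Π⋆ v 1 n)
  Π⋆-multiples-from-1 r' w v off on n =
    ≈-trans (Π⋆-skip w r' 1 (suc r' * n) (λ i i<r' → off (suc i) (λ p → <⇒≱ (s≤s i<r') (∣⇒≤ p))))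
    (≈-trans (λ m → cong (λ q → Π⋆ w q (suc r' * n) m) (sym (*-identityʳ (suc r'))))
             (Π⋆-multiples r' w v off on 0 n))

  distinctDiv-off : ∀ r i → ¬ (r ∣ i) → factor (distinctDiv r) i ≈ ε
  distinctDiv-off r zero nd = ⊥-elim (nd (divides 0 refl))
  distinctDiv-off r (suc i) nd = ≈-trans (dilate-cong (suc i) weight≈ε) (dilate-ε i)
    where
    weight≈ε : distinctDiv r (suc i) ≈ ε
    weight≈ε zero = refl
    weight≈ε (suc zero) = ind-no (r ∣? suc i) nd
    weight≈ε (suc (suc m)) = refl

  distinctDiv-on : ∀ r' t → factor (distinctDiv (suc r')) (suc r' * suc t) ≈ dilate (suc r') (factor (λ _ → once) (suc t))
  distinctDiv-on r' t = ≈-trans (dilate-cong j weight≈once) (dilate-dilate r' t once)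
    where
    j = suc r' * suc t
    weight≈once : distinctDiv (suc r') j ≈ once
    weight≈once zero = refl
    weight≈once (suc zero) = ind-yes (suc r' ∣? j) (m∣m*n (suc t))
    weight≈once (suc (suc m)) = refl

  distinctDiv-Π⋆ : ∀ r' n → Π⋆ (distinctDiv (suc r')) 1 (r' + suc r' * n) ≈ dilate (suc r') (distinct≤ n)
  distinctDiv-Π⋆ r' = Π⋆-multiples-from-1 r' (distinctDiv (suc r')) (λ _ → once) (distinctDiv-off (suc r')) (distinctDiv-on r')

  under-< : ∀ r {m} → m < r → under r m ≡ 1
  under-< r {m} = ind-yes (suc m ≤? r)

  under-≥ : ∀ r {m} → r ≤ m → under r m ≡ 0
  under-≥ r {m} r≤m = ind-no (suc m ≤? r) (<⇒≱ (s≤s r≤m))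

  ones-factor : ∀ r' → ones ≈ (under (suc r') ⋆ dilate (suc r') ones)
  ones-factor r' = fixpoint-unique r' (under r) ones (under r ⋆ G) ones-rec product-rec
    where
    r = suc r'
    G = dilate r ones
    ones-rec : ones ≈ (under r ⊕ shift r ones)
    ones-rec m with r ≤? m
    ... | no m<r = sym (cong₂ _+_ (under-< r (≰⇒> m<r)) (shift-low r ones m (≰⇒> m<r)))
    ... | yes r≤m = sym (cong₂ _+_ (under-≥ r r≤m) (shift-≤ r ones r≤m))
    product-rec : (under r ⋆ G) ≈ (under r ⊕ shift r (under r ⋆ G))
    product-rec m = begin
      (under r ⋆ G) m                               ≡⟨ ⋆-congʳ (under r) (ones-dilate r') m ⟩
      (under r ⋆ (ε ⊕ shift r G)) m                 ≡⟨ ⋆-distribˡ (under r) ε (shift r G) m ⟩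
      (under r ⋆ ε) m + (under r ⋆ shift r G) m     ≡⟨ cong₂ _+_ (⋆-ε (under r) m) (⋆-shift r (under r) G m) ⟩
      under r m + shift r (under r ⋆ G) m           ∎

  atMost-factor : ∀ r' j → atMost (suc r') j ≈ (under (suc r') ⋆ dilate (suc r') once)
  atMost-factor r' j m = trans (split m) (sym (product m))
    where
    r = suc r'
    top : 2 * r ∸ 1 ≡ r' + r
    top = cong (λ x → r' + suc x) (+-identityʳ r')
    split : ∀ m → atMost r j m ≡ under r m + shift r (under r) m
    split m with r ≤? m
    ... | no m<r = trans (ind-yes (m ≤? 2 * r ∸ 1) (subst (m ≤_) (sym top) (≤-trans (≤-pred (≰⇒> m<r)) (m≤m+n r' r))))
                         (sym (cong₂ _+_ (under-< r (≰⇒> m<r)) (shift-low r (under r) m (≰⇒> m<r))))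
    ... | yes r≤m = trans (ind-⇔ (m ≤? 2 * r ∸ 1) (suc (m ∸ r) ≤? r) to from)
                          (sym (cong₂ _+_ (under-≥ r r≤m) (shift-≤ r (under r) r≤m)))
      where
      to : m ≤ 2 * r ∸ 1 → suc (m ∸ r) ≤ r
      to le = s≤s (≤-trans (∸-monoˡ-≤ r (subst (m ≤_) top le)) (≤-reflexive (m+n∸n≡m r' r)))
      from : suc (m ∸ r) ≤ r → m ≤ 2 * r ∸ 1
      from (s≤s le) = subst (m ≤_) (sym top) (subst (_≤ r' + r) (m+[n∸m]≡n r≤m) (≤-trans (+-monoʳ-≤ r le) (≤-reflexive (+-comm r r'))))
    product : (under r ⋆ dilate r once) ≈ (under r ⊕ shift r (under r))
    product m = begin
      (under r ⋆ dilate r once) m                   ≡⟨ ⋆-congʳ (under r) (once-dilate r') m ⟩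
      (under r ⋆ (ε ⊕ shift r ε)) m                 ≡⟨ ⋆-distribˡ (under r) ε (shift r ε) m ⟩
      (under r ⋆ ε) m + (under r ⋆ shift r ε) m     ≡⟨ cong₂ _+_ (⋆-ε (under r) m) (trans (⋆-shift r (under r) ε m) (shift-cong r (⋆-ε (under r)) m)) ⟩
      under r m + shift r (under r) m               ∎

  partitions-factor : ∀ r' k → partitions≤ k ≈ (underProd (suc r') k ⋆ dilate (suc r') (partitions≤ k))
  partitions-factor r' k =
    ≈-trans (Π⋆-⋆ (λ _ → ones) (λ _ → under (suc r')) (λ _ → dilate (suc r') ones) 0 k (λ _ → ones-factor r'))
            (⋆-congʳ (underProd (suc r') k) (Π⋆-dilate r' (λ _ → ones) 0 k))

  atMost-Π⋆ : ∀ r' k → Π⋆ (atMost (suc r')) 1 k ≈ (underProd (suc r') k ⋆ dilate (suc r') (distinct≤ k))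
  atMost-Π⋆ r' k =
    ≈-trans (Π⋆-⋆ (atMost (suc r')) (λ _ → under (suc r')) (λ _ → dilate (suc r') once) 0 k (λ j → atMost-factor r' (suc j)))
            (⋆-congʳ (underProd (suc r') k) (Π⋆-dilate r' (λ _ → once) 0 k))

module SeriesIdentity where

  open import Data.Nat
  open import Data.Nat.Properties
  open import Relation.Binary.PropositionalEquality
  open ≡-Reasoning
  open Sums
  open PowerSeries
  open Dilation
  open WeightedProducts
  open PartitionSeries
  open SubsetSums using (tri)
  open GaussIdentity
  open Factorizations

  gauss≤ : ∀ n → ΣS (suc n) (λ i → shift (tri i) (partitions≤ n)) ≈[ n ] (distinct≤ n ⋆ distinct≤ n)
  gauss≤ n y y≤n = sym (begin
    (distinct≤ n ⋆ distinct≤ n) y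
      ≡⟨ ⋆-cong≤ y (Π⋆-stable (λ _ → once) n (suc y) y (λ _ → refl) y≤n (n≤1+n y))
                   (Π⋆-stable (λ _ → once) n y y (λ _ → refl) y≤n ≤-refl) y ≤-refl ⟩
    (distinct≤ (suc y) ⋆ distinct≤ y) y
      ≡⟨ gauss y ⟩
    Σ< (suc y) (λ j → shift (tri j) (partitions≤ y) y)
      ≡⟨ Σ-cong (suc y) (λ j _ → shift-cong≤ (tri j) y (Π⋆-stable (λ _ → ones) y n y (λ _ → refl) ≤-refl y≤n) y ≤-refl) ⟩
    Σ< (suc y) (λ j → shift (tri j) (partitions≤ n) y)
      ≡⟨ Σ-extend (suc y) (suc n) _ (s≤s y≤n) (λ j y<j _ → shift-low (tri j) (partitions≤ n) y (<-≤-trans y<j (≤-tri j))) ⟩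
    Σ< (suc n) (λ j → shift (tri j) (partitions≤ n) y) ∎)

  σ-side : ∀ r' n → let r = suc r' in
    ΣS (suc n) (λ i → shift (r * tri i) (partitions≤ n)) ≈
    (underProd r n ⋆ dilate r (ΣS (suc n) (λ i → shift (tri i) (partitions≤ n))))
  σ-side r' n x = begin
    Σ< (suc n) (λ i → shift (r * tri i) (P n) x)
      ≡⟨ Σ-cong (suc n) (λ i _ → term i) ⟩
    ΣS (suc n) (λ i → underProd r n ⋆ dilate r (shift (tri i) (P n))) x
      ≡⟨ sym (⋆-ΣS (underProd r n) (suc n) (λ i → dilate r (shift (tri i) (P n))) x) ⟩
    (underProd r n ⋆ ΣS (suc n) (λ i → dilate r (shift (tri i) (P n)))) x
      ≡⟨ ⋆-congʳ (underProd r n) (≈-sym (dilate-ΣS r (suc n) (λ i → shift (tri i) (P n)))) x ⟩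
    (underProd r n ⋆ dilate r (ΣS (suc n) (λ i → shift (tri i) (P n)))) x ∎
    where
    r = suc r'
    P = partitions≤
    term : ∀ i → shift (r * tri i) (P n) x ≡ (underProd r n ⋆ dilate r (shift (tri i) (P n))) x
    term i = begin
      shift (r * tri i) (P n) x                                   ≡⟨ shift-cong (r * tri i) (partitions-factor r' n) x ⟩
      shift (r * tri i) (underProd r n ⋆ dilate r (P n)) x        ≡⟨ sym (⋆-shift (r * tri i) (underProd r n) (dilate r (P n)) x) ⟩
      (underProd r n ⋆ shift (r * tri i) (dilate r (P n))) x      ≡⟨ ⋆-congʳ (underProd r n) (dilate-shift r' (tri i) (P n)) x ⟩
      (underProd r n ⋆ dilate r (shift (tri i) (P n))) x          ∎

  two-colour-side : ∀ r' n → let r = suc r' in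
    (Π⋆ (distinctDiv r) 1 n ⋆ Π⋆ (atMost r) 1 n) n ≡ (underProd r n ⋆ dilate r (distinct≤ n ⋆ distinct≤ n)) n
  two-colour-side r' n = begin
    (Π⋆ (distinctDiv r) 1 n ⋆ Π⋆ (atMost r) 1 n) n
      ≡⟨ ⋆-cong≤ n distinctDiv≤ (λ x _ → atMost-Π⋆ r' n x) n ≤-refl ⟩
    (U ⋆ (underProd r n ⋆ U)) n
      ≡⟨ sym (⋆-assoc U (underProd r n) U n) ⟩
    (U ⋆ underProd r n ⋆ U) n
      ≡⟨ ⋆-cong (⋆-comm U (underProd r n)) (≈-refl {U}) n ⟩
    (underProd r n ⋆ U ⋆ U) n
      ≡⟨ ⋆-assoc (underProd r n) U U n ⟩
    (underProd r n ⋆ (U ⋆ U)) n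
      ≡⟨ ⋆-congʳ (underProd r n) (≈-sym (dilate-⋆ r' (distinct≤ n) (distinct≤ n))) n ⟩
    (underProd r n ⋆ dilate r (distinct≤ n ⋆ distinct≤ n)) n ∎
    where
    r = suc r'
    U = dilate r (distinct≤ n)
    n≤ : n ≤ r' + r * n
    n≤ = ≤-trans (m≤n*m n r) (m≤n+m (r * n) r')
    distinctDiv≤ : Π⋆ (distinctDiv r) 1 n ≈[ n ] U
    distinctDiv≤ x x≤n = trans (Π⋆-stable (distinctDiv r) n (r' + r * n) n (λ _ → refl) ≤-refl n≤ x x≤n) (distinctDiv-Π⋆ r' n x)

  series-identity : ∀ r' n →
    Σ< (suc n) (λ i → shift (suc r' * tri i) (partitions≤ n) n) ≡ (Π⋆ (distinctDiv (suc r')) 1 n ⋆ Π⋆ (atMost (suc r')) 1 n) n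
  series-identity r' n = begin
    Σ< (suc n) (λ i → shift (r * tri i) (partitions≤ n) n)
      ≡⟨ σ-side r' n n ⟩
    (underProd r n ⋆ dilate r (ΣS (suc n) (λ i → shift (tri i) (partitions≤ n)))) n
      ≡⟨ ⋆-cong≤ {underProd r n} n (λ _ _ → refl) (dilate-cong≤ r n (gauss≤ n)) n ≤-refl ⟩
    (underProd r n ⋆ dilate r (distinct≤ n ⋆ distinct≤ n)) n
      ≡⟨ sym (two-colour-side r' n) ⟩
    (Π⋆ (distinctDiv r) 1 n ⋆ Π⋆ (atMost r) 1 n) n ∎
    where
    r = suc r'

module ListSums where

  open import Data.Nat
  open import Data.Nat.Properties
  open import Data.List using (List; []; _∷_; map; concatMap; filter; length; upTo; applyUpTo)
  open import Data.List.Properties using (map-++; map-cong; map-∘)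
  open import Data.Nat.ListAction using (sum)
  import Data.Nat.ListAction.Properties as ListAction
  open import Data.Vec using (Vec; []; _∷_)
  open import Data.Bool using (true; false)
  open import Relation.Binary.PropositionalEquality
  open import Relation.Nullary using (Dec; does)
  open Sums
  open Defs using (vecs)

  module _ {A : Set} where

    sum-filter : ∀ {p} {Q : A → Set p} (Q? : ∀ x → Dec (Q x)) (f : A → ℕ) (xs : List A) →
      sum (map f (filter Q? xs)) ≡ sum (map (λ x → ind (Q? x) * f x) xs)
    sum-filter Q? f [] = refl
    sum-filter Q? f (x ∷ xs) with does (Q? x)
    ... | true = cong₂ _+_ (sym (+-identityʳ (f x))) (sum-filter Q? f xs)
    ... | false = sum-filter Q? f xs

    length-filter : ∀ {p} {Q : A → Set p} (Q? : ∀ x → Dec (Q x)) (xs : List A) →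
      length (filter Q? xs) ≡ sum (map (λ x → ind (Q? x)) xs)
    length-filter Q? [] = refl
    length-filter Q? (x ∷ xs) with does (Q? x)
    ... | true = cong suc (length-filter Q? xs)
    ... | false = length-filter Q? xs

    sum-cong : ∀ {f g : A → ℕ} (xs : List A) → (∀ x → f x ≡ g x) → sum (map f xs) ≡ sum (map g xs)
    sum-cong xs e = cong sum (map-cong e xs)

    sum-Σ : ∀ (xs : List A) m (h : ℕ → A → ℕ) → sum (map (λ x → Σ< m (λ i → h i x)) xs) ≡ Σ< m (λ i → sum (map (h i) xs))
    sum-Σ [] m h = sym (Σ-zero m _ (λ _ _ → refl))
    sum-Σ (x ∷ xs) m h = trans (cong (Σ< m (λ i → h i x) +_) (sum-Σ xs m h)) (sym (Σ-+ m (λ i → h i x) _))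

    sum-*ˡ : ∀ (xs : List A) c (f : A → ℕ) → sum (map (λ x → c * f x) xs) ≡ c * sum (map f xs)
    sum-*ˡ [] c f = sym (*-zeroʳ c)
    sum-*ˡ (x ∷ xs) c f = trans (cong (c * f x +_) (sum-*ˡ xs c f)) (sym (*-distribˡ-+ c (f x) _))

  module _ {A B : Set} where

    sum-map : ∀ (f : B → ℕ) (g : A → B) xs → sum (map f (map g xs)) ≡ sum (map (λ x → f (g x)) xs)
    sum-map f g xs = cong sum (sym (map-∘ xs))

    sum-concatMap : ∀ (f : B → ℕ) (g : A → List B) xs → sum (map f (concatMap g xs)) ≡ sum (map (λ x → sum (map f (g x))) xs)
    sum-concatMap f g [] = refl
    sum-concatMap f g (x ∷ xs) =
      trans (cong sum (map-++ f (g x) (concatMap g xs)))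
      (trans (ListAction.sum-++ (map f (g x)) (map f (concatMap g xs)))
             (cong (sum (map f (g x)) +_) (sum-concatMap f g xs)))

  sum-applyUpTo : ∀ (f : ℕ → ℕ) (g : ℕ → ℕ) m → sum (map f (applyUpTo g m)) ≡ Σ< m (λ i → f (g i))
  sum-applyUpTo f g zero = refl
  sum-applyUpTo f g (suc m) = cong (f (g 0) +_) (sum-applyUpTo f (λ i → g (suc i)) m)

  sum-vecs : ∀ k B (h : Vec ℕ (suc k) → ℕ) → sum (map h (vecs (suc k) B)) ≡ Σ< (suc B) (λ x → sum (map (λ v → h (x ∷ v)) (vecs k B)))
  sum-vecs k B h = trans (sum-concatMap h (λ x → map (x ∷_) (vecs k B)) (upTo (suc B)))
                     (trans (sum-applyUpTo (λ x → sum (map h (map (x ∷_) (vecs k B)))) (λ i → i) (suc B))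
                            (Σ-cong (suc B) (λ x _ → sum-map h (x ∷_) (vecs k B))))

module Counting where

  open import Data.Nat
  open import Data.Nat.Properties
  open import Data.Nat.Tactic.RingSolver as ℕ-Solver using ()
  open import Data.List using (map)
  open import Data.Nat.ListAction using (sum)
  open import Data.Vec using (Vec; []; _∷_)
  open import Relation.Binary.PropositionalEquality
  open import Relation.Nullary using (yes; no)
  open ≡-Reasoning
  open Defs using (vecs; weightFrom)
  open Sums
  open Dilation
  open WeightedProducts
  open ListSums

  weightProd : Weight → ℕ → ∀ {k} → Vec ℕ k → ℕ
  weightProd w j [] = 1
  weightProd w j (m ∷ ms) = w j m * weightProd w (suc j) ms

  ind-+-split : ∀ a w n → ind (a + w ≟ n) ≡ ι≤ a n * ind (w ≟ n ∸ a)
  ind-+-split a w n with a ≤? n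
  ... | yes a≤n = trans (cong (λ q → ind (a + w ≟ q)) (sym (m+[n∸m]≡n a≤n)))
                        (trans (cancel (n ∸ a)) (sym (trans (cong (_* ind (w ≟ n ∸ a)) (ind-yes (a ≤? n) a≤n)) (+-identityʳ _))))
    where
    cancel : ∀ c → ind (a + w ≟ a + c) ≡ ind (w ≟ c)
    cancel c with w ≟ c
    ... | yes q = trans (ind-yes (a + w ≟ a + c) (cong (a +_) q)) (sym (ind-yes (w ≟ c) q))
    ... | no q = trans (ind-no (a + w ≟ a + c) (λ p → q (+-cancelˡ-≡ a w c p))) (sym (ind-no (w ≟ c) q))
  ... | no a≰n = trans (ind-no (a + w ≟ n) (λ p → a≰n (subst (a ≤_) p (m≤m+n a w))))
                       (sym (cong (_* ind (w ≟ n ∸ a)) (ind-no (a ≤? n) a≰n)))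

  count-Π⋆ : ∀ (w : Weight) k j' B n → n ≤ B →
    sum (map (λ v → ind (weightFrom (suc j') v ≟ n) * weightProd w (suc j') v) (vecs k B)) ≡ Π⋆ w (suc j') k n
  count-Π⋆ w zero j' B zero _ = refl
  count-Π⋆ w zero j' B (suc n) _ = refl
  count-Π⋆ w (suc k) j' B n n≤B = begin
    sum (map (λ v → ind (weightFrom j v ≟ n) * weightProd w j v) (vecs (suc k) B))
      ≡⟨ sum-vecs k B _ ⟩
    Σ< (suc B) (λ x → sum (map (λ v → ind (j * x + weightFrom (suc j) v ≟ n) * (w j x * weightProd w (suc j) v)) (vecs k B)))
      ≡⟨ Σ-cong (suc B) (λ x _ → head x) ⟩
    Σ< (suc B) (λ x → ι≤ (j * x) n * (w j x * Π⋆ w (suc j) k (n ∸ j * x)))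
      ≡⟨ sym (Σ-extend (suc n) (suc B) _ (s≤s n≤B) (λ x n<x _ → cong (_* (w j x * Π⋆ w (suc j) k (n ∸ j * x))) (too-big x n<x))) ⟩
    Σ< (suc n) (λ x → ι≤ (j * x) n * (w j x * Π⋆ w (suc j) k (n ∸ j * x)))
      ≡⟨ sym (dilate-⋆-coeff j' (w j) (Π⋆ w (suc j) k) n) ⟩
    Π⋆ w j (suc k) n ∎
    where
    j = suc j'
    rearrange : ∀ a b c d → a * b * (c * d) ≡ a * (c * (b * d))
    rearrange = ℕ-Solver.solve-∀
    head : ∀ x → sum (map (λ v → ind (j * x + weightFrom (suc j) v ≟ n) * (w j x * weightProd w (suc j) v)) (vecs k B))
               ≡ ι≤ (j * x) n * (w j x * Π⋆ w (suc j) k (n ∸ j * x))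
    head x = begin
      sum (map (λ v → ind (j * x + weightFrom (suc j) v ≟ n) * (w j x * weightProd w (suc j) v)) (vecs k B))
        ≡⟨ sum-cong (vecs k B) (λ v → trans (cong (_* (w j x * weightProd w (suc j) v)) (ind-+-split (j * x) (weightFrom (suc j) v) n))
                                              (rearrange (ι≤ (j * x) n) (ind (weightFrom (suc j) v ≟ n ∸ j * x)) (w j x) (weightProd w (suc j) v))) ⟩
      sum (map (λ v → ι≤ (j * x) n * (w j x * (ind (weightFrom (suc j) v ≟ n ∸ j * x) * weightProd w (suc j) v))) (vecs k B))
        ≡⟨ trans (sum-*ˡ (vecs k B) (ι≤ (j * x) n) _) (cong (ι≤ (j * x) n *_) (sum-*ˡ (vecs k B) (w j x) _)) ⟩
      ι≤ (j * x) n * (w j x * sum (map (λ v → ind (weightFrom (suc j) v ≟ n ∸ j * x) * weightProd w (suc j) v) (vecs k B)))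
        ≡⟨ cong (λ q → ι≤ (j * x) n * (w j x * q)) (count-Π⋆ w k (suc j') B (n ∸ j * x) (≤-trans (m∸n≤m n (j * x)) n≤B)) ⟩
      ι≤ (j * x) n * (w j x * Π⋆ w (suc j) k (n ∸ j * x)) ∎
    too-big : ∀ x → suc n ≤ x → ι≤ (j * x) n ≡ 0
    too-big x n<x = ind-no (j * x ≤? n) (λ p → <⇒≱ n<x (≤-trans (m≤n*m x j) p))

-- The r-gap of a partition is the number of
-- i ≥ 0 such that each of the parts 1, …, i occurs at least r times, and
-- the partitions with this property are counted by q^{r·T(i)}/(q;q)_∞.
module GapSums where

  open import Data.Nat
  open import Data.Nat.Properties
  open import Data.List using (map; filter)
  open import Data.Nat.ListAction using (sum)
  open import Data.Vec using (Vec; []; _∷_)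
  open import Relation.Binary.PropositionalEquality
  open import Relation.Nullary using (Dec; yes; no; ¬_)
  open import Data.Empty using (⊥-elim)
  open ≡-Reasoning
  open Defs using (vecs; weight; gap; σmex)
  open Sums
  open PowerSeries
  open Dilation
  open WeightedProducts
  open PartitionSeries
  open SubsetSums using (tri)
  open ListSums
  open Counting

  covers : ℕ → ℕ → ∀ {k} → Vec ℕ k → ℕ
  covers r zero v = 1
  covers r (suc i) [] = 1
  covers r (suc i) (m ∷ ms) = ι≤ r m * covers r i ms

  gap-Σ : ∀ r' {k} (v : Vec ℕ k) → gap (suc r') v ≡ Σ< (suc k) (λ i → covers (suc r') i v)
  gap-Σ r' [] = refl
  gap-Σ r' {suc k} (m ∷ ms) with m <? suc r'
  ... | yes m<r = sym (cong suc (Σ-zero (suc k) _ (λ i _ → cong (_* covers (suc r') i ms) (ind-no (suc r' ≤? m) (<⇒≱ m<r)))))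
  ... | no m≮r = cong suc (trans (gap-Σ r' ms) (Σ-cong (suc k) (λ i _ →
                   sym (trans (cong (_* covers (suc r') i ms) (ind-yes (suc r' ≤? m) (≮⇒≥ m≮r))) (+-identityʳ _)))))

  atLeast : ℕ → Series
  atLeast r m = ι≤ r m

  coverWeight : ℕ → ℕ → Weight
  coverWeight r t j with j ≤? t
  ... | yes _ = atLeast r
  ... | no _ = ones

  coverWeight-≤ : ∀ r t j → j ≤ t → coverWeight r t j ≈ atLeast r
  coverWeight-≤ r t j j≤t m with j ≤? t
  ... | yes _ = refl
  ... | no j≰t = ⊥-elim (j≰t j≤t)

  coverWeight-> : ∀ r t j → ¬ (j ≤ t) → coverWeight r t j ≈ ones
  coverWeight-> r t j j≰t m with j ≤? t
  ... | yes j≤t = ⊥-elim (j≰t j≤t)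
  ... | no _ = refl

  weightProd-beyond : ∀ r t j {k} (v : Vec ℕ k) → t < j → weightProd (coverWeight r t) j v ≡ 1
  weightProd-beyond r t j [] _ = refl
  weightProd-beyond r t j (m ∷ ms) t<j =
    cong₂ _*_ (coverWeight-> r t j (<⇒≱ t<j) m) (weightProd-beyond r t (suc j) ms (≤-trans t<j (n≤1+n j)))

  covers-weightProd : ∀ r i c {k} (v : Vec ℕ k) → covers r i v ≡ weightProd (coverWeight r (i + c)) (suc c) v
  covers-weightProd r zero c [] = refl
  covers-weightProd r zero c (m ∷ ms) =
    sym (cong₂ _*_ (coverWeight-> r c (suc c) (<⇒≱ (n<1+n c)) m) (weightProd-beyond r c (suc (suc c)) ms (≤-trans (n<1+n c) (n≤1+n _))))
  covers-weightProd r (suc i) c [] = refl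
  covers-weightProd r (suc i) c (m ∷ ms) =
    cong₂ _*_ (sym (coverWeight-≤ r (suc i + c) (suc c) (s≤s (m≤n+m c i)) m))
              (trans (covers-weightProd r i (suc c) ms) (cong (λ t → weightProd (coverWeight r t) (suc (suc c)) ms) (+-suc i c)))

  sizesUpTo : ℕ → ℕ → ℕ → ℕ
  sizesUpTo i j' zero = 0
  sizesUpTo i j' (suc k) with suc j' ≤? i
  ... | yes _ = suc j' + sizesUpTo i (suc j') k
  ... | no _ = sizesUpTo i (suc j') k

  sizesUpTo-beyond : ∀ i j' k → i < suc j' → sizesUpTo i j' k ≡ 0
  sizesUpTo-beyond i j' zero _ = refl
  sizesUpTo-beyond i j' (suc k) i≤j' with suc j' ≤? i
  ... | yes j<i = ⊥-elim (<⇒≱ i≤j' j<i)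
  ... | no _ = sizesUpTo-beyond i (suc j') k (≤-trans i≤j' (n≤1+n _))

  sizesUpTo-tri : ∀ i j' k → j' ≤ i → i ≤ j' + k → sizesUpTo i j' k + tri j' ≡ tri i
  sizesUpTo-tri i j' zero j'≤i i≤ = cong tri (≤-antisym j'≤i (subst (i ≤_) (+-identityʳ j') i≤))
  sizesUpTo-tri i j' (suc k) j'≤i i≤ with suc j' ≤? i
  ... | yes j<i = begin
    suc j' + sizesUpTo i (suc j') k + tri j'   ≡⟨ +-assoc (suc j') _ (tri j') ⟩
    suc j' + (sizesUpTo i (suc j') k + tri j') ≡⟨ cong (suc j' +_) (+-comm _ (tri j')) ⟩
    suc j' + (tri j' + sizesUpTo i (suc j') k) ≡⟨ sym (+-assoc (suc j') (tri j') _) ⟩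
    tri (suc j') + sizesUpTo i (suc j') k      ≡⟨ +-comm (tri (suc j')) _ ⟩
    sizesUpTo i (suc j') k + tri (suc j')      ≡⟨ sizesUpTo-tri i (suc j') k j<i (subst (i ≤_) (+-suc j' k) i≤) ⟩
    tri i                                      ∎
  ... | no j≮i = trans (cong (_+ tri j') (sizesUpTo-beyond i (suc j') k (s≤s (≤-trans (≤-reflexive i≡j') (n≤1+n j'))))) (cong tri (sym i≡j'))
    where
    i≡j' : i ≡ j'
    i≡j' = ≤-antisym (≤-pred (≰⇒> j≮i)) j'≤i

  sizesUpTo-yes : ∀ i j' k → suc j' ≤ i → sizesUpTo i j' (suc k) ≡ suc j' + sizesUpTo i (suc j') k
  sizesUpTo-yes i j' k j<i with suc j' ≤? i
  ... | yes _ = refl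
  ... | no j≮i = ⊥-elim (j≮i j<i)

  sizesUpTo-no : ∀ i j' k → ¬ (suc j' ≤ i) → sizesUpTo i j' (suc k) ≡ sizesUpTo i (suc j') k
  sizesUpTo-no i j' k j≮i with suc j' ≤? i
  ... | yes j<i = ⊥-elim (j≮i j<i)
  ... | no _ = refl

  atLeast-shift : ∀ r → atLeast r ≈ shift r ones
  atLeast-shift r m with r ≤? m
  ... | yes r≤m = trans (ind-yes (r ≤? m) r≤m) (sym (shift-≤ r ones r≤m))
  ... | no r≰m = trans (ind-no (r ≤? m) r≰m) (sym (shift-low r ones m (≰⇒> r≰m)))

  Π⋆-coverWeight : ∀ r' i j' k → Π⋆ (coverWeight (suc r') i) (suc j') k ≈ shift (suc r' * sizesUpTo i j' k) (Π⋆ (λ _ → ones) (suc j') k)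
  Π⋆-coverWeight r' i j' zero n = cong (λ q → shift q ε n) (sym (*-zeroʳ (suc r')))
  Π⋆-coverWeight r' i j' (suc k) = by-cases (suc j' ≤? i)
    where
    r = suc r'
    P₁ = Π⋆ (λ _ → ones)
    IH = Π⋆-coverWeight r' i (suc j') k
    by-cases : Dec (suc j' ≤ i) → Π⋆ (coverWeight r i) (suc j') (suc k) ≈ shift (r * sizesUpTo i j' (suc k)) (P₁ (suc j') (suc k))
    by-cases (yes j<i) =
      ≈-trans (⋆-cong factor-shift IH)
      (≈-trans (shift-⋆-shift (suc j' * r) (r * sizesUpTo i (suc j') k) (factor (λ _ → ones) (suc j')) (P₁ (2+ j') k))
               (λ n → cong (λ q → shift q (P₁ (suc j') (suc k)) n) exponent))
      where
      factor-shift : factor (coverWeight r i) (suc j') ≈ shift (suc j' * r) (factor (λ _ → ones) (suc j'))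
      factor-shift = ≈-trans (dilate-cong (suc j') (≈-trans (coverWeight-≤ r i (suc j') j<i) (atLeast-shift r)))
                             (≈-sym (dilate-shift j' r ones))
      exponent : suc j' * r + r * sizesUpTo i (suc j') k ≡ r * sizesUpTo i j' (suc k)
      exponent = trans (cong (_+ r * sizesUpTo i (suc j') k) (*-comm (suc j') r))
                 (trans (sym (*-distribˡ-+ r (suc j') _)) (cong (r *_) (sym (sizesUpTo-yes i j' k j<i))))
    by-cases (no j≮i) =
      ≈-trans (⋆-cong (dilate-cong (suc j') (coverWeight-> r i (suc j') j≮i)) IH)
      (≈-trans (⋆-shift (r * sizesUpTo i (suc j') k) (factor (λ _ → ones) (suc j')) (P₁ (2+ j') k))
               (λ n → cong (λ q → shift (r * q) (P₁ (suc j') (suc k)) n) (sym (sizesUpTo-no i j' k j≮i))))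

  covering-count : ∀ r' n i → i ≤ n →
    sum (map (λ v → ind (weight v ≟ n) * covers (suc r') i v) (vecs n n)) ≡ shift (suc r' * tri i) (partitions≤ n) n
  covering-count r' n i i≤n = begin
    sum (map (λ v → ind (weight v ≟ n) * covers r i v) (vecs n n))
      ≡⟨ sum-cong (vecs n n) (λ v → cong (ind (weight v ≟ n) *_)
           (trans (covers-weightProd r i 0 v) (cong (λ t → weightProd (coverWeight r t) 1 v) (+-identityʳ i)))) ⟩
    sum (map (λ v → ind (weight v ≟ n) * weightProd (coverWeight r i) 1 v) (vecs n n))
      ≡⟨ count-Π⋆ (coverWeight r i) n 0 n n ≤-refl ⟩
    Π⋆ (coverWeight r i) 1 n n
      ≡⟨ Π⋆-coverWeight r' i 0 n n ⟩
    shift (r * sizesUpTo i 0 n) (partitions≤ n) n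
      ≡⟨ cong (λ q → shift (r * q) (partitions≤ n) n) (trans (sym (+-identityʳ _)) (sizesUpTo-tri i 0 n z≤n i≤n)) ⟩
    shift (r * tri i) (partitions≤ n) n ∎
    where
    r = suc r'

  σmex-series : ∀ r' n → σmex (suc r') n ≡ Σ< (suc n) (λ i → shift (suc r' * tri i) (partitions≤ n) n)
  σmex-series r' n = begin
    sum (map (gap r) (filter (λ m → weight m ≟ n) (vecs n n)))
      ≡⟨ sum-filter (λ m → weight m ≟ n) (gap r) (vecs n n) ⟩
    sum (map (λ v → ind (weight v ≟ n) * gap r v) (vecs n n))
      ≡⟨ sum-cong (vecs n n) (λ v → trans (cong (ind (weight v ≟ n) *_) (gap-Σ r' v)) (sym (Σ-*ˡ (suc n) (ind (weight v ≟ n)) (λ i → covers r i v)))) ⟩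
    sum (map (λ v → Σ< (suc n) (λ i → ind (weight v ≟ n) * covers r i v)) (vecs n n))
      ≡⟨ sum-Σ (vecs n n) (suc n) (λ i v → ind (weight v ≟ n) * covers r i v) ⟩
    Σ< (suc n) (λ i → sum (map (λ v → ind (weight v ≟ n) * covers r i v) (vecs n n)))
      ≡⟨ Σ-cong (suc n) (λ i i<sn → covering-count r' n i (≤-pred i<sn)) ⟩
    Σ< (suc n) (λ i → shift (r * tri i) (partitions≤ n) n) ∎
    where
    r = suc r'

module TwoColourCount where

  open import Data.Nat
  open import Data.Nat.Properties
  open import Data.Nat.Tactic.RingSolver as ℕ-Solver using ()
  open import Data.List using (List; map; filter; length)
  open import Data.Nat.ListAction using (sum)
  open import Data.Vec using (Vec; []; _∷_)
  open import Data.Product using (_,_)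
  open import Relation.Binary.PropositionalEquality
  open import Relation.Nullary using (Dec; yes; no; _×-dec_)
  open ≡-Reasoning
  open import Defs
  open Sums
  open PowerSeries
  open WeightedProducts
  open ListSums
  open Counting
  open Factorizations using (distinctDiv; atMost)

  ind-allFrom : ∀ (Q : ℕ → ℕ → Set) (Q? : ∀ j m → Dec (Q j m)) j {k} (v : Vec ℕ k) →
    ind (allFrom? Q Q? j v) ≡ weightProd (λ j m → ind (Q? j m)) j v
  ind-allFrom Q Q? j [] = refl
  ind-allFrom Q Q? j (m ∷ ms) = trans (ind-× (Q? j m) (allFrom? Q Q? (suc j) ms)) (cong (ind (Q? j m) *_) (ind-allFrom Q Q? (suc j) ms))

  group-by-weight : ∀ {k} (xs : List (Vec ℕ k)) (Π : Vec ℕ k → ℕ) (g : ℕ → ℕ) n → (∀ s → n < s → g s ≡ 0) →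
    sum (map (λ a → Π a * g (weight a)) xs) ≡ Σ< (suc n) (λ s → sum (map (λ a → ind (weight a ≟ s) * Π a) xs) * g s)
  group-by-weight xs Π g n g0 = begin
    sum (map (λ a → Π a * g (weight a)) xs)
      ≡⟨ sum-cong xs select ⟩
    sum (map (λ a → Σ< (suc n) (λ s → δ (weight a) s * Π a * g s)) xs)
      ≡⟨ sum-Σ xs (suc n) (λ s a → δ (weight a) s * Π a * g s) ⟩
    Σ< (suc n) (λ s → sum (map (λ a → δ (weight a) s * Π a * g s) xs))
      ≡⟨ Σ-cong (suc n) (λ s _ → trans (sum-cong xs (λ a → *-comm (δ (weight a) s * Π a) (g s))) (trans (sum-*ˡ xs (g s) _) (*-comm (g s) _))) ⟩
    Σ< (suc n) (λ s → sum (map (λ a → ind (weight a ≟ s) * Π a) xs) * g s) ∎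
    where
    select : ∀ a → Π a * g (weight a) ≡ Σ< (suc n) (λ s → δ (weight a) s * Π a * g s)
    select a with weight a ≤? n
    ... | yes le = sym (trans (Σ-cong (suc n) (λ s _ → *-assoc (δ (weight a) s) (Π a) (g s))) (Σ-δ (suc n) (weight a) (λ s → Π a * g s) (s≤s le)))
    ... | no nle = trans (trans (cong (Π a *_) (g0 (weight a) (≰⇒> nle))) (*-zeroʳ (Π a)))
                         (sym (trans (Σ-cong (suc n) (λ s _ → *-assoc (δ (weight a) s) (Π a) (g s))) (Σ-δ-out (suc n) (weight a) (λ s → Π a * g s) (≰⇒> nle))))

  module _ (r n : ℕ) where

    ΠA ΠB : Vec ℕ n → ℕ
    ΠA a = weightProd (distinctDiv r) 1 a
    ΠB b = weightProd (atMost r) 1 b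

    partners : ℕ → ℕ
    partners s = ι≤ s n * Π⋆ (atMost r) 1 n (n ∸ s)

    partners-big : ∀ s → n < s → partners s ≡ 0
    partners-big s n<s = cong (_* Π⋆ (atMost r) 1 n (n ∸ s)) (ind-no (s ≤? n) (<⇒≱ n<s))

    good-split : ∀ a b → ind (good? r n (a , b)) ≡ ΠA a * (ι≤ (weight a) n * (ind (weight b ≟ n ∸ weight a) * ΠB b))
    good-split a b = begin
      ind (good? r n (a , b))
        ≡⟨ ind-× (weight a + weight b ≟ n) (allA ×-dec allB) ⟩
      ind (weight a + weight b ≟ n) * ind (allA ×-dec allB)
        ≡⟨ cong₂ _*_ (ind-+-split (weight a) (weight b) n)
                     (trans (ind-× allA allB) (cong₂ _*_ (ind-allFrom (DistinctDivBy r) (distinctDivBy? r) 1 a) (ind-allFrom (AtMost r) (atMost? r) 1 b))) ⟩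
      ι≤ (weight a) n * ind (weight b ≟ n ∸ weight a) * (ΠA a * ΠB b)
        ≡⟨ rearrange (ι≤ (weight a) n) (ind (weight b ≟ n ∸ weight a)) (ΠA a) (ΠB b) ⟩
      ΠA a * (ι≤ (weight a) n * (ind (weight b ≟ n ∸ weight a) * ΠB b)) ∎
      where
      allA = allFrom? (DistinctDivBy r) (distinctDivBy? r) 1 a
      allB = allFrom? (AtMost r) (atMost? r) 1 b
      rearrange : ∀ x y p q → x * y * (p * q) ≡ p * (x * (y * q))
      rearrange = ℕ-Solver.solve-∀

    pairs-with : ∀ a → sum (map (λ p → ind (good? r n p)) (map (a ,_) (vecs n n))) ≡ ΠA a * partners (weight a)
    pairs-with a = begin
      sum (map (λ p → ind (good? r n p)) (map (a ,_) (vecs n n)))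
        ≡⟨ sum-map (λ p → ind (good? r n p)) (a ,_) (vecs n n) ⟩
      sum (map (λ b → ind (good? r n (a , b))) (vecs n n))
        ≡⟨ sum-cong (vecs n n) (good-split a) ⟩
      sum (map (λ b → ΠA a * (ι≤ (weight a) n * (ind (weight b ≟ n ∸ weight a) * ΠB b))) (vecs n n))
        ≡⟨ trans (sum-*ˡ (vecs n n) (ΠA a) _) (cong (ΠA a *_) (sum-*ˡ (vecs n n) (ι≤ (weight a) n) _)) ⟩
      ΠA a * (ι≤ (weight a) n * sum (map (λ b → ind (weight b ≟ n ∸ weight a) * ΠB b) (vecs n n)))
        ≡⟨ cong (λ q → ΠA a * (ι≤ (weight a) n * q)) (count-Π⋆ (atMost r) n 0 n (n ∸ weight a) (m∸n≤m n (weight a))) ⟩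
      ΠA a * partners (weight a) ∎

  D2-series : ∀ r n → D2 r n ≡ (Π⋆ (distinctDiv r) 1 n ⋆ Π⋆ (atMost r) 1 n) n
  D2-series r n = begin
    length (filter (good? r n) (pairs n))
      ≡⟨ length-filter (good? r n) (pairs n) ⟩
    sum (map (λ p → ind (good? r n p)) (pairs n))
      ≡⟨ sum-concatMap (λ p → ind (good? r n p)) (λ a → map (a ,_) (vecs n n)) (vecs n n) ⟩
    sum (map (λ a → sum (map (λ p → ind (good? r n p)) (map (a ,_) (vecs n n)))) (vecs n n))
      ≡⟨ sum-cong (vecs n n) (pairs-with r n) ⟩
    sum (map (λ a → ΠA r n a * partners r n (weight a)) (vecs n n))
      ≡⟨ group-by-weight (vecs n n) (ΠA r n) (partners r n) n (partners-big r n) ⟩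
    Σ< (suc n) (λ s → sum (map (λ a → ind (weight a ≟ s) * ΠA r n a) (vecs n n)) * partners r n s)
      ≡⟨ Σ-cong (suc n) (λ s s<sn → cong₂ _*_ (count-Π⋆ (distinctDiv r) n 0 n s (≤-pred s<sn))
                                              (trans (cong (_* Π⋆ (atMost r) 1 n (n ∸ s)) (ind-yes (s ≤? n) (≤-pred s<sn))) (+-identityʳ _))) ⟩
    Σ< (suc n) (λ s → Π⋆ (distinctDiv r) 1 n s * Π⋆ (atMost r) 1 n (n ∸ s))
      ≡⟨ sym (diag-Σ n _) ⟩
    (Π⋆ (distinctDiv r) 1 n ⋆ Π⋆ (atMost r) 1 n) n ∎

theorem7 : (n r : ℕ) → r > 0 → σmex r n ≡ D2 r n
theorem7 n (suc r') _ = begin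
  σmex (suc r') n
    ≡⟨ σmex-series r' n ⟩
  Σ< (suc n) (λ i → shift (suc r' * tri i) (partitions≤ n) n)
    ≡⟨ series-identity r' n ⟩
  (Π⋆ (distinctDiv (suc r')) 1 n ⋆ Π⋆ (atMost (suc r')) 1 n) n
    ≡⟨ sym (D2-series (suc r') n) ⟩
  D2 (suc r') n ∎
  where
  open ≡-Reasoning
  open Sums using (Σ<)
  open PowerSeries using (shift; _⋆_)
  open WeightedProducts using (Π⋆)
  open PartitionSeries using (partitions≤)
  open SubsetSums using (tri)
  open Factorizations using (distinctDiv; atMost)
  open SeriesIdentity using (series-identity)
  open GapSums using (σmex-series)
  open TwoColourCount using (D2-series)
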